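{- Let $q$ be a prime power. Given $0<\varepsilon<\tfrac12$ and a natural number $a$, there is $n_0=n_0(\varepsilon,a)$ (independent of $q$) such that for all $n\ge n_0$, $$\sum_{\substack{Q \text{ monic}\\ \deg Q>n}}\frac{|\mu(Q)|\,2^{a\,\omega(Q)}}{q^{2\deg Q}}\le 3\,q^{ -(1-\varepsilon)n},$$ the sum running over monic polynomials $Q\in\mathbb{F}_q[z]$.
   Context: $\omega(Q)$ is the number of distinct monic irreducible factors of $Q$; $\mu(Q)=0$ if $Q$ is divisible by the square of an irreducible polynomial and $\mu(Q)=(-1)^{\omega(Q)}$ otherwise.
   Formalization: The parameter ε takes only rational values in the interval (0, 1/2). -}

module Defs where

open import Level using (0ℓ)
open import Data.Bool using (Bool; true; false; _∧_; _∨_; not; if_then_else_)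
open import Data.Nat as ℕ using (ℕ; zero; suc; _∸_; _^_; _≤ᵇ_; _≡ᵇ_; NonZero)
open import Data.Nat.Properties using (m^n≢0)
open import Data.Integer as ℤ using (ℤ; +_; -_; ∣_∣)
open import Data.Rational as ℚ using (ℚ; _/_; 0ℚ; 1ℚ)
open import Data.List using (List; []; _∷_; [_]; _++_; map; concatMap; length; upTo; foldr)
open import Data.Bool.ListAction using (any; all)
open import Data.List.Relation.Unary.Any using (Any)
open import Data.List.Relation.Unary.AllPairs using (AllPairs)
open import Data.Vec using (Vec; toList) renaming ([] to []ᵛ; _∷_ to _∷ᵛ_)
open import Data.Product using (∃)
open import Relation.Nullary using (¬_; isYes)
open import Relation.Binary using (Decidable)
open import Algebra.Bundles using (CommutativeRing)

record FiniteField : Set₁ where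
  field
    commRing : CommutativeRing 0ℓ 0ℓ
  open CommutativeRing commRing public
  field
    0≉1      : ¬ (0# ≈ 1#)
    inverse  : ∀ x → ¬ (x ≈ 0#) → ∃ λ y → x * y ≈ 1#
    _≟_      : Decidable _≈_
    elements : List Carrier
    complete : ∀ x → Any (x ≈_) elements
    distinct : AllPairs (λ x y → ¬ (x ≈ y)) elements

powℚ : ℚ → ℕ → ℚ
powℚ x zero    = 1ℚ
powℚ x (suc n) = x ℚ.* powℚ x n

sumℚ : List ℚ → ℚ
sumℚ = foldr ℚ._+_ 0ℚ

sumℕ : List ℕ → ℕ
sumℕ = foldr ℕ._+_ 0

countB : {A : Set} → (A → Bool) → List A → ℕ
countB p []       = 0
countB p (x ∷ xs) = if p x then suc (countB p xs) else countB p xs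

signPow : ℕ → ℤ
signPow zero    = + 1
signPow (suc k) = - signPow k

private
  anyNZ : {A : Set} {P : A → Set} {xs : List A} → Any P xs → NonZero (length xs)
  anyNZ {xs = x ∷ xs} _ = _

module FF (F : FiniteField) where
  open FiniteField F

  q : ℕ
  q = length elements

  instance
    q≢0 : NonZero q
    q≢0 = anyNZ (complete 0#)

  -- polynomials as coefficient lists, constant term first
  Poly : Set
  Poly = List Carrier

  monic : ∀ {d} → Vec Carrier d → Poly
  monic v = toList v ++ [ 1# ]

  vecs : (d : ℕ) → List (Vec Carrier d)
  vecs zero    = []ᵛ ∷ []
  vecs (suc d) = concatMap (λ x → map (x ∷ᵛ_) (vecs d)) elements

  addP : Poly → Poly → Poly
  addP []       r        = r
  addP p        []       = p
  addP (a ∷ p)  (b ∷ r)  = (a + b) ∷ addP p r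

  mulP : Poly → Poly → Poly
  mulP []      r = []
  mulP (a ∷ p) r = addP (map (a *_) r) (0# ∷ mulP p r)

  eqP : Poly → Poly → Bool
  eqP []      []      = true
  eqP (a ∷ p) (b ∷ r) = isYes (a ≟ b) ∧ eqP p r
  eqP _       _       = false

  divides? : ℕ → ℕ → Poly → Poly → Bool
  divides? d e P Q =
    (d ≤ᵇ e) ∧ any (λ r → eqP (mulP P (monic r)) Q) (vecs (e ∸ d))

  irreducible? : ℕ → Poly → Bool
  irreducible? d P =
    (1 ≤ᵇ d) ∧ all (λ k → (k ≡ᵇ 0) ∨ all (λ r → not (divides? k d (monic r) P)) (vecs k)) (upTo d)

  ω : (e : ℕ) → Vec Carrier e → ℕ
  ω e Q = sumℕ (map (λ d → countB (λ r → irreducible? d (monic r) ∧ divides? d e (monic r) (monic Q)) (vecs d)) (upTo (suc e)))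

  squarefree? : (e : ℕ) → Vec Carrier e → Bool
  squarefree? e Q =
    all (λ d → all (λ r → not (irreducible? d (monic r) ∧ divides? (2 ℕ.* d) e (mulP (monic r) (monic r)) (monic Q))) (vecs d)) (upTo (suc e))

  μ : (e : ℕ) → Vec Carrier e → ℤ
  μ e Q = if squarefree? e Q then signPow (ω e Q) else + 0

  term : ℕ → (e : ℕ) → Vec Carrier e → ℚ
  term a e Q = _/_ (+ (∣ μ e Q ∣ ℕ.* 2 ^ (a ℕ.* ω e Q))) (q ^ (2 ℕ.* e)) {{m^n≢0 q (2 ℕ.* e)}}

  degSum : ℕ → ℕ → ℚ
  degSum a e = sumℚ (map (term a e) (vecs e))

  partialSum : ℕ → ℕ → ℕ → ℚ
  partialSum a n m = sumℚ (map (λ j → degSum a (suc (n ℕ.+ j))) (upTo m))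

module Submission where

-- Since |μ| ≤ 1 and there are q ^ e monic polynomials of degree e, the degree-e part of the sum
-- is at most q ^ (- e) · max 2 ^ (a ω(Q)). The distinct monic irreducible divisors of Q have
-- degrees summing to at most deg Q (Euclid's lemma in F[z]), and at most q ^ d of them have
-- degree d; hence (t + 1) ω(Q) ≤ (t + 1) ^ 2 q ^ t + deg Q for every t. Taking t = 0 when
-- q ≥ 2 ^ (4aD) and t = 4aD otherwise gives 2 ^ (a ω(Q)) ≤ q ^ (n / D + ⌈j/2⌉) for
-- deg Q = n + 1 + j once n ≥ n₀(a, D), so the degree-(n + 1 + j) part is at most
-- q ^ (- (n - n / D) - 1 - ⌊j/2⌋). Each exponent occurs for two values of j, so summing with
-- q ≥ 2 bounds the tail by 2 q ^ (- (n - n / D)), and (n - n / D) D ≥ (D - k) n.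

open import Level using (0ℓ)
import Algebra.Properties.CommutativeSemigroup as CommutativeSemigroupProperties
import Algebra.Properties.Group as GroupProperties
import Algebra.Properties.Ring as RingProperties
open import Data.Bool using (Bool; true; false; T; _∧_; not)
open import Data.Bool.ListAction using (any)
open import Data.Bool.Properties using (T-∧; T-not-≡)
open import Data.Empty using (⊥-elim)
open import Data.Integer as ℤ using (∣_∣)
import Data.Integer.Properties as ℤ
open import Data.List as List using (List; []; _∷_; [_]; _++_; map; length; concatMap; filter; upTo)
import Data.List.Properties as List
open import Data.List.Membership.Propositional using (_∈_; find; lose)
open import Data.List.Membership.Propositional.Properties
  using (∈-concatMap⁺; ∈-concatMap⁻; ∈-map⁺; ∈-map⁻; ∈-filter⁻; ∈-upTo⁺)
open import Data.List.Relation.Unary.All as All using (All; []; _∷_)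
import Data.List.Relation.Unary.All.Properties as All
open import Data.List.Relation.Unary.AllPairs as AllPairs using (AllPairs; []; _∷_)
import Data.List.Relation.Unary.AllPairs.Properties as AllPairs
open import Data.List.Relation.Unary.Any as Any using (Any; here)
import Data.List.Relation.Unary.Any.Properties as Any
import Data.List.Relation.Unary.Unique.Propositional.Properties as Unique
open import Data.Nat as ℕ using (ℕ; zero; suc; _≤_; _<_; z≤n; s≤s; _∸_; _^_; _⊔_; NonZero; ⌊_/2⌋; ⌈_/2⌉)
import Data.Nat.ListAction.Properties as Sum
import Data.Nat.Properties as ℕ
open import Data.Nat.Induction using (<-wellFounded)
open import Data.Nat.Solver using (module +-*-Solver)
open import Data.Product using (Σ; ∃; ∃-syntax; _×_; _,_; proj₁; proj₂)
open import Data.Rational as ℚ using (ℚ; 0ℚ; toℚᵘ)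
import Data.Rational.Properties as ℚ
import Data.Rational.Unnormalised as ℚᵘ
import Data.Rational.Unnormalised.Properties as ℚᵘ
open import Data.Sum using (_⊎_; inj₁; inj₂)
open import Data.Vec as Vec using (Vec; toList; initLast) renaming ([] to []ᵛ; _∷_ to _∷ᵛ_)
import Data.Vec.Properties as Vec
open import Function using (_∘_; id; Equivalence)
open import Induction.WellFounded using (Acc; acc)
open import Relation.Binary.Bundles using (Setoid)
import Relation.Binary.Reasoning.Setoid as SetoidReasoning
open import Relation.Binary.PropositionalEquality as ≡ using (_≡_)
open import Relation.Nullary using (¬_; yes; no)
open import Relation.Nullary.Decidable using (T?)
open import Relation.Unary using (Decidable)
open import Defs
open +-*-Solver using (solve; _:+_; _:*_; _:=_; con)

module _ {A B : Set} (f : A → List B) where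

  length-concatMap-const : ∀ {n} → (∀ x → length (f x) ≡ n) → ∀ xs → length (concatMap f xs) ≡ length xs ℕ.* n
  length-concatMap-const lengths []       = ≡.refl
  length-concatMap-const lengths (x ∷ xs) =
    ≡.trans (List.length-++ (f x)) (≡.cong₂ ℕ._+_ (lengths x) (length-concatMap-const lengths xs))

  sum-map-concatMap : ∀ (g : B → ℕ) xs → sumℕ (map g (concatMap f xs)) ≡ sumℕ (map (λ x → sumℕ (map g (f x))) xs)
  sum-map-concatMap g []       = ≡.refl
  sum-map-concatMap g (x ∷ xs) = begin
    sumℕ (map g (f x ++ concatMap f xs))                ≡⟨ ≡.cong sumℕ (List.map-++ g (f x) (concatMap f xs)) ⟩
    sumℕ (map g (f x) ++ map g (concatMap f xs))        ≡⟨ Sum.sum-++ (map g (f x)) (map g (concatMap f xs)) ⟩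
    sumℕ (map g (f x)) ℕ.+ sumℕ (map g (concatMap f xs)) ≡⟨ ≡.cong (sumℕ (map g (f x)) ℕ.+_) (sum-map-concatMap g xs) ⟩
    sumℕ (map (λ x → sumℕ (map g (f x))) (x ∷ xs))      ∎
    where open ≡.≡-Reasoning

  AllPairs-concatMap⁺ : ∀ {R : B → B → Set} {xs} → (∀ x → AllPairs R (f x)) →
    AllPairs (λ x y → ∀ {u v} → u ∈ f x → v ∈ f y → R u v) xs → AllPairs R (concatMap f xs)
  AllPairs-concatMap⁺ {xs = []}     inside []                 = []
  AllPairs-concatMap⁺ {xs = x ∷ xs} inside (across ∷ acrosses) =
    AllPairs.++⁺ (inside x) (AllPairs-concatMap⁺ inside acrosses)
      (All.tabulate λ u∈fx → All.tabulate λ v∈rest →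
        let y , y∈xs , v∈fy = find (∈-concatMap⁻ f {xs = xs} v∈rest) in All.lookup across y∈xs u∈fx v∈fy)

sumUpTo : (ℕ → ℕ) → ℕ → ℕ
sumUpTo f n = sumℕ (map f (upTo n))

sumUpTo-suc : ∀ f n → sumUpTo f (suc n) ≡ sumUpTo f n ℕ.+ f n
sumUpTo-suc f n = begin
  sumℕ (map f (upTo (suc n)))           ≡⟨ ≡.cong (sumℕ ∘ map f) (List.applyUpTo-∷ʳ id n) ⟨
  sumℕ (map f (upTo n ++ [ n ]))        ≡⟨ ≡.cong sumℕ (List.map-++ f (upTo n) [ n ]) ⟩
  sumℕ (map f (upTo n) ++ [ f n ])      ≡⟨ Sum.sum-++ (map f (upTo n)) [ f n ] ⟩
  sumUpTo f n ℕ.+ (f n ℕ.+ 0)           ≡⟨ ≡.cong (sumUpTo f n ℕ.+_) (ℕ.+-identityʳ (f n)) ⟩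
  sumUpTo f n ℕ.+ f n                   ∎
  where open ≡.≡-Reasoning

countB≡length-filter : ∀ {A : Set} (p : A → Bool) xs → countB p xs ≡ length (filter (T? ∘ p) xs)
countB≡length-filter p []       = ≡.refl
countB≡length-filter p (x ∷ xs) with p x
... | true  = ≡.cong suc (countB≡length-filter p xs)
... | false = countB≡length-filter p xs

module Polynomials (F : FiniteField) where
  open FiniteField F hiding (zero)
  open FF F
  open RingProperties ring using (-1*x≈-x)
  open CommutativeSemigroupProperties +-commutativeSemigroup using (interchange; x∙yz≈y∙xz)
  open GroupProperties +-group using (\\-leftDividesˡ)

  -- Ring laws for coefficient lists
  coeff : Poly → ℕ → Carrier
  coeff []      i       = 0#
  coeff (a ∷ p) zero    = a
  coeff (a ∷ p) (suc i) = coeff p i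

  infix 4 _≋_
  record _≋_ (p r : Poly) : Set where
    constructor mk≋
    field coeff-≈ : ∀ i → coeff p i ≈ coeff r i
  open _≋_

  ≋-setoid : Setoid 0ℓ 0ℓ
  ≋-setoid = record
    { Carrier       = Poly
    ; _≈_           = _≋_
    ; isEquivalence = record
      { refl  = mk≋ λ i → refl
      ; sym   = λ h → mk≋ λ i → sym (coeff-≈ h i)
      ; trans = λ h g → mk≋ λ i → trans (coeff-≈ h i) (coeff-≈ g i)
      }
    }

  open Setoid ≋-setoid using () renaming (refl to ≋-refl; sym to ≋-sym; trans to ≋-trans; reflexive to ≋-reflexive)
  module ≋-Reasoning = SetoidReasoning ≋-setoid

  ∷-cong : ∀ {a b p r} → a ≈ b → p ≋ r → a ∷ p ≋ b ∷ r
  ∷-cong a≈b p≋r = mk≋ λ { zero → a≈b ; (suc i) → coeff-≈ p≋r i }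

  ≋-head : ∀ {a b p r} → a ∷ p ≋ b ∷ r → a ≈ b
  ≋-head h = coeff-≈ h 0

  ≋-tail : ∀ {a b p r} → a ∷ p ≋ b ∷ r → p ≋ r
  ≋-tail h = mk≋ λ i → coeff-≈ h (suc i)

  []≋∷-head : ∀ {b r} → [] ≋ b ∷ r → b ≈ 0#
  []≋∷-head h = sym (coeff-≈ h 0)

  []≋∷-tail : ∀ {b r} → [] ≋ b ∷ r → [] ≋ r
  []≋∷-tail h = mk≋ λ i → coeff-≈ h (suc i)

  ∷≋[]-tail : ∀ {b r} → b ∷ r ≋ [] → r ≋ []
  ∷≋[]-tail h = mk≋ λ i → coeff-≈ h (suc i)

  0∷-≋[] : ∀ {b r} → b ≈ 0# → r ≋ [] → b ∷ r ≋ []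
  0∷-≋[] b≈0 r≋[] = mk≋ λ { zero → b≈0 ; (suc i) → coeff-≈ r≋[] i }

  coeff-addP : ∀ p r i → coeff (addP p r) i ≈ coeff p i + coeff r i
  coeff-addP []      r       i       = sym (+-identityˡ _)
  coeff-addP (a ∷ p) []      i       = sym (+-identityʳ _)
  coeff-addP (a ∷ p) (b ∷ r) zero    = refl
  coeff-addP (a ∷ p) (b ∷ r) (suc i) = coeff-addP p r i

  scale : Carrier → Poly → Poly
  scale a = map (a *_)

  coeff-scale : ∀ a p i → coeff (scale a p) i ≈ a * coeff p i
  coeff-scale a []      i       = sym (zeroʳ a)
  coeff-scale a (b ∷ p) zero    = refl
  coeff-scale a (b ∷ p) (suc i) = coeff-scale a p i

  addP-cong : ∀ {p p′ r r′} → p ≋ p′ → r ≋ r′ → addP p r ≋ addP p′ r′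
  addP-cong {p} {p′} {r} {r′} h g = mk≋ λ i →
    trans (coeff-addP p r i) (trans (+-cong (coeff-≈ h i) (coeff-≈ g i)) (sym (coeff-addP p′ r′ i)))

  addP-congˡ : ∀ r {p p′} → p ≋ p′ → addP p r ≋ addP p′ r
  addP-congˡ r h = addP-cong h ≋-refl

  addP-congʳ : ∀ p {r r′} → r ≋ r′ → addP p r ≋ addP p r′
  addP-congʳ p h = addP-cong {p} ≋-refl h

  addP-comm : ∀ p r → addP p r ≋ addP r p
  addP-comm p r = mk≋ λ i →
    trans (coeff-addP p r i) (trans (+-comm _ _) (sym (coeff-addP r p i)))

  addP-assoc : ∀ p r s → addP (addP p r) s ≋ addP p (addP r s)
  addP-assoc p r s = mk≋ λ i → begin
    coeff (addP (addP p r) s) i           ≈⟨ trans (coeff-addP (addP p r) s i) (+-congʳ (coeff-addP p r i)) ⟩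
    (coeff p i + coeff r i) + coeff s i   ≈⟨ +-assoc _ _ _ ⟩
    coeff p i + (coeff r i + coeff s i)   ≈⟨ trans (coeff-addP p (addP r s) i) (+-congˡ (coeff-addP r s i)) ⟨
    coeff (addP p (addP r s)) i           ∎
    where open SetoidReasoning setoid

  addP-interchange : ∀ w x y z → addP (addP w x) (addP y z) ≋ addP (addP w y) (addP x z)
  addP-interchange w x y z = mk≋ λ i → begin
    coeff (addP (addP w x) (addP y z)) i
      ≈⟨ trans (coeff-addP (addP w x) (addP y z) i) (+-cong (coeff-addP w x i) (coeff-addP y z i)) ⟩
    (coeff w i + coeff x i) + (coeff y i + coeff z i)
      ≈⟨ interchange _ _ _ _ ⟩
    (coeff w i + coeff y i) + (coeff x i + coeff z i)
      ≈⟨ trans (coeff-addP (addP w y) (addP x z) i) (+-cong (coeff-addP w y i) (coeff-addP x z i)) ⟨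
    coeff (addP (addP w y) (addP x z)) i ∎
    where open SetoidReasoning setoid

  addP-leftComm : ∀ x y z → addP x (addP y z) ≋ addP y (addP x z)
  addP-leftComm x y z = mk≋ λ i → begin
    coeff (addP x (addP y z)) i        ≈⟨ trans (coeff-addP x (addP y z) i) (+-congˡ (coeff-addP y z i)) ⟩
    coeff x i + (coeff y i + coeff z i) ≈⟨ x∙yz≈y∙xz _ _ _ ⟩
    coeff y i + (coeff x i + coeff z i) ≈⟨ trans (coeff-addP y (addP x z) i) (+-congˡ (coeff-addP x z i)) ⟨
    coeff (addP y (addP x z)) i        ∎
    where open SetoidReasoning setoid

  addP-identityʳ : ∀ {p r} → r ≋ [] → addP p r ≋ p
  addP-identityʳ {p} {r} r≋[] = mk≋ λ i →
    trans (coeff-addP p r i) (trans (+-congˡ (coeff-≈ r≋[] i)) (+-identityʳ _))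

  addP-identityˡ : ∀ {p r} → p ≋ [] → addP p r ≋ r
  addP-identityˡ {p} {r} p≋[] = ≋-trans (addP-comm p r) (addP-identityʳ p≋[])

  addP-inverseʳ : ∀ p → addP p (scale (- 1#) p) ≋ []
  addP-inverseʳ p = mk≋ λ i → begin
    coeff (addP p (scale (- 1#) p)) i  ≈⟨ trans (coeff-addP p (scale (- 1#) p) i) (+-congˡ (coeff-scale (- 1#) p i)) ⟩
    coeff p i + - 1# * coeff p i       ≈⟨ +-congˡ (-1*x≈-x _) ⟩
    coeff p i + - coeff p i            ≈⟨ -‿inverseʳ _ ⟩
    0#                                 ∎
    where open SetoidReasoning setoid

  scale-cong : ∀ {a b p r} → a ≈ b → p ≋ r → scale a p ≋ scale b r
  scale-cong {a} {b} {p} {r} a≈b h = mk≋ λ i →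
    trans (coeff-scale a p i) (trans (*-cong a≈b (coeff-≈ h i)) (sym (coeff-scale b r i)))

  scale-congˡ : ∀ p {a b} → a ≈ b → scale a p ≋ scale b p
  scale-congˡ p a≈b = scale-cong {p = p} a≈b ≋-refl

  scale-congʳ : ∀ a {p r} → p ≋ r → scale a p ≋ scale a r
  scale-congʳ a h = scale-cong refl h

  scale-distribˡ : ∀ a p r → scale a (addP p r) ≋ addP (scale a p) (scale a r)
  scale-distribˡ a p r = mk≋ λ i → begin
    coeff (scale a (addP p r)) i                ≈⟨ trans (coeff-scale a (addP p r) i) (*-congˡ (coeff-addP p r i)) ⟩
    a * (coeff p i + coeff r i)                 ≈⟨ distribˡ a _ _ ⟩
    a * coeff p i + a * coeff r i               ≈⟨ trans (coeff-addP (scale a p) (scale a r) i)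
                                                         (+-cong (coeff-scale a p i) (coeff-scale a r i)) ⟨
    coeff (addP (scale a p) (scale a r)) i      ∎
    where open SetoidReasoning setoid

  scale-distribʳ : ∀ a b p → scale (a + b) p ≋ addP (scale a p) (scale b p)
  scale-distribʳ a b p = mk≋ λ i → begin
    coeff (scale (a + b) p) i                   ≈⟨ coeff-scale (a + b) p i ⟩
    (a + b) * coeff p i                         ≈⟨ distribʳ _ a b ⟩
    a * coeff p i + b * coeff p i               ≈⟨ trans (coeff-addP (scale a p) (scale b p) i)
                                                         (+-cong (coeff-scale a p i) (coeff-scale b p i)) ⟨
    coeff (addP (scale a p) (scale b p)) i      ∎
    where open SetoidReasoning setoid

  scale-assoc : ∀ a b p → scale a (scale b p) ≋ scale (a * b) p
  scale-assoc a b p = mk≋ λ i → begin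
    coeff (scale a (scale b p)) i  ≈⟨ trans (coeff-scale a (scale b p) i) (*-congˡ (coeff-scale b p i)) ⟩
    a * (b * coeff p i)            ≈⟨ *-assoc a b _ ⟨
    a * b * coeff p i              ≈⟨ coeff-scale (a * b) p i ⟨
    coeff (scale (a * b) p) i      ∎
    where open SetoidReasoning setoid

  scale-identity : ∀ p → scale 1# p ≋ p
  scale-identity p = mk≋ λ i → trans (coeff-scale 1# p i) (*-identityˡ _)

  scale-zeroˡ : ∀ p → scale 0# p ≋ []
  scale-zeroˡ p = mk≋ λ i → trans (coeff-scale 0# p i) (zeroˡ _)

  scale-zeroʳ : ∀ a {p} → p ≋ [] → scale a p ≋ []
  scale-zeroʳ a {p} p≋[] = mk≋ λ i → trans (coeff-scale a p i) (trans (*-congˡ (coeff-≈ p≋[] i)) (zeroʳ a))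

  0∷-addP : ∀ p r → 0# ∷ addP p r ≋ addP (0# ∷ p) (0# ∷ r)
  0∷-addP p r = ∷-cong (sym (+-identityʳ 0#)) ≋-refl

  0∷-scale : ∀ a p → 0# ∷ scale a p ≋ scale a (0# ∷ p)
  0∷-scale a p = ∷-cong (sym (zeroʳ a)) ≋-refl

  mulP-zeroˡ : ∀ {p} r → p ≋ [] → mulP p r ≋ []
  mulP-zeroˡ {[]}    r h = ≋-refl
  mulP-zeroˡ {a ∷ p} r h = ≋-trans (addP-identityʳ (0∷-≋[] refl (mulP-zeroˡ r (∷≋[]-tail h))))
                                   (≋-trans (scale-congˡ r (coeff-≈ h 0)) (scale-zeroˡ r))

  mulP-zeroʳ : ∀ p {r} → r ≋ [] → mulP p r ≋ []
  mulP-zeroʳ []      h = ≋-refl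
  mulP-zeroʳ (a ∷ p) h = ≋-trans (addP-identityʳ (0∷-≋[] refl (mulP-zeroʳ p h))) (scale-zeroʳ a h)

  mulP-congˡ : ∀ {p p′} r → p ≋ p′ → mulP p r ≋ mulP p′ r
  mulP-congˡ {[]}    {p′}     r h = ≋-sym (mulP-zeroˡ r (≋-sym h))
  mulP-congˡ {a ∷ p} {[]}     r h = mulP-zeroˡ r h
  mulP-congˡ {a ∷ p} {b ∷ p′} r h = addP-cong (scale-congˡ r (≋-head h)) (∷-cong refl (mulP-congˡ r (≋-tail h)))

  mulP-congʳ : ∀ p {r r′} → r ≋ r′ → mulP p r ≋ mulP p r′
  mulP-congʳ []      h = ≋-refl
  mulP-congʳ (a ∷ p) h = addP-cong (scale-congʳ a h) (∷-cong refl (mulP-congʳ p h))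

  mulP-consʳ : ∀ p a r → mulP p (a ∷ r) ≋ addP (scale a p) (0# ∷ mulP p r)
  mulP-consʳ []      a r = ≋-sym (0∷-≋[] refl ≋-refl)
  mulP-consʳ (b ∷ p) a r = ∷-cong (+-congʳ (*-comm b a)) (begin
    addP (scale b r) (mulP p (a ∷ r))                      ≈⟨ addP-congʳ (scale b r) (mulP-consʳ p a r) ⟩
    addP (scale b r) (addP (scale a p) (0# ∷ mulP p r))    ≈⟨ addP-leftComm (scale b r) (scale a p) _ ⟩
    addP (scale a p) (addP (scale b r) (0# ∷ mulP p r))    ∎)
    where open ≋-Reasoning

  mulP-comm : ∀ p r → mulP p r ≋ mulP r p
  mulP-comm []      r = ≋-sym (mulP-zeroʳ r ≋-refl)
  mulP-comm (a ∷ p) r =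
    ≋-trans (addP-congʳ (scale a r) (∷-cong refl (mulP-comm p r))) (≋-sym (mulP-consʳ r a p))

  mulP-distribʳ : ∀ p p′ r → mulP (addP p p′) r ≋ addP (mulP p r) (mulP p′ r)
  mulP-distribʳ []      p′       r = ≋-refl
  mulP-distribʳ (a ∷ p) []       r = ≋-sym (addP-identityʳ ≋-refl)
  mulP-distribʳ (a ∷ p) (b ∷ p′) r = begin
    addP (scale (a + b) r) (0# ∷ mulP (addP p p′) r)
      ≈⟨ addP-cong (scale-distribʳ a b r) (∷-cong refl (mulP-distribʳ p p′ r)) ⟩
    addP (addP (scale a r) (scale b r)) (0# ∷ addP (mulP p r) (mulP p′ r))
      ≈⟨ addP-congʳ (addP (scale a r) (scale b r)) (0∷-addP (mulP p r) (mulP p′ r)) ⟩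
    addP (addP (scale a r) (scale b r)) (addP (0# ∷ mulP p r) (0# ∷ mulP p′ r))
      ≈⟨ addP-interchange (scale a r) (scale b r) _ _ ⟩
    addP (mulP (a ∷ p) r) (mulP (b ∷ p′) r) ∎
    where open ≋-Reasoning

  mulP-distribˡ : ∀ p r r′ → mulP p (addP r r′) ≋ addP (mulP p r) (mulP p r′)
  mulP-distribˡ p r r′ = begin
    mulP p (addP r r′)               ≈⟨ mulP-comm p (addP r r′) ⟩
    mulP (addP r r′) p               ≈⟨ mulP-distribʳ r r′ p ⟩
    addP (mulP r p) (mulP r′ p)      ≈⟨ addP-cong (mulP-comm r p) (mulP-comm r′ p) ⟩
    addP (mulP p r) (mulP p r′)      ∎
    where open ≋-Reasoning

  mulP-scaleˡ : ∀ a p r → mulP (scale a p) r ≋ scale a (mulP p r)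
  mulP-scaleˡ a []      r = ≋-refl
  mulP-scaleˡ a (b ∷ p) r = begin
    addP (scale (a * b) r) (0# ∷ mulP (scale a p) r)    ≈⟨ addP-cong (≋-sym (scale-assoc a b r)) (∷-cong refl (mulP-scaleˡ a p r)) ⟩
    addP (scale a (scale b r)) (0# ∷ scale a (mulP p r)) ≈⟨ addP-congʳ (scale a (scale b r)) (0∷-scale a (mulP p r)) ⟩
    addP (scale a (scale b r)) (scale a (0# ∷ mulP p r)) ≈⟨ scale-distribˡ a (scale b r) _ ⟨
    scale a (mulP (b ∷ p) r)                             ∎
    where open ≋-Reasoning

  mulP-scaleʳ : ∀ a p r → mulP p (scale a r) ≋ scale a (mulP p r)
  mulP-scaleʳ a p r =
    ≋-trans (mulP-comm p (scale a r)) (≋-trans (mulP-scaleˡ a r p) (scale-congʳ a (mulP-comm r p)))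

  mulP-shiftˡ : ∀ p r → mulP (0# ∷ p) r ≋ 0# ∷ mulP p r
  mulP-shiftˡ p r = addP-identityˡ (scale-zeroˡ r)

  mulP-assoc : ∀ p r s → mulP (mulP p r) s ≋ mulP p (mulP r s)
  mulP-assoc []      r s = ≋-refl
  mulP-assoc (a ∷ p) r s = begin
    mulP (addP (scale a r) (0# ∷ mulP p r)) s               ≈⟨ mulP-distribʳ (scale a r) _ s ⟩
    addP (mulP (scale a r) s) (mulP (0# ∷ mulP p r) s)      ≈⟨ addP-cong (mulP-scaleˡ a r s) (mulP-shiftˡ (mulP p r) s) ⟩
    addP (scale a (mulP r s)) (0# ∷ mulP (mulP p r) s)      ≈⟨ addP-congʳ (scale a (mulP r s)) (∷-cong refl (mulP-assoc p r s)) ⟩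
    addP (scale a (mulP r s)) (0# ∷ mulP p (mulP r s))      ∎
    where open ≋-Reasoning

  mulP-identityˡ : ∀ p → mulP [ 1# ] p ≋ p
  mulP-identityˡ p = ≋-trans (addP-identityʳ (0∷-≋[] refl ≋-refl)) (scale-identity p)

  mulP-identityʳ : ∀ p → mulP p [ 1# ] ≋ p
  mulP-identityʳ p = ≋-trans (mulP-comm p [ 1# ]) (mulP-identityˡ p)

  -- Leading coefficients and division by monic polynomials
  snoc : ∀ {n} → Vec Carrier n → Carrier → Poly
  snoc v c = toList v ++ [ c ]

  length-snoc : ∀ {n} (v : Vec Carrier n) c → length (snoc v c) ≡ suc n
  length-snoc []ᵛ       c = ≡.refl
  length-snoc (x ∷ᵛ v) c = ≡.cong suc (length-snoc v c)

  snoc-cong : ∀ {n} {v w : Vec Carrier n} {γ δ} → toList v ≋ toList w → γ ≈ δ → snoc v γ ≋ snoc w δ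
  snoc-cong {v = []ᵛ}     {[]ᵛ}     h γ≈δ = ∷-cong γ≈δ ≋-refl
  snoc-cong {v = x ∷ᵛ v} {y ∷ᵛ w} h γ≈δ = ∷-cong (≋-head h) (snoc-cong (≋-tail h) γ≈δ)

  snoc-injective : ∀ {n} (v w : Vec Carrier n) {γ δ} → snoc v γ ≋ snoc w δ → toList v ≋ toList w
  snoc-injective []ᵛ       []ᵛ       h = ≋-refl
  snoc-injective (x ∷ᵛ v) (y ∷ᵛ w) h = ∷-cong (≋-head h) (snoc-injective v w (≋-tail h))

  []≋snoc⇒≈0 : ∀ {n} (v : Vec Carrier n) {γ} → [] ≋ snoc v γ → γ ≈ 0#
  []≋snoc⇒≈0 []ᵛ       h = []≋∷-head h
  []≋snoc⇒≈0 (x ∷ᵛ v) h = []≋snoc⇒≈0 v ([]≋∷-tail h)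

  snoc-≋-degree : ∀ {m n} (v : Vec Carrier m) (w : Vec Carrier n) {γ δ} → ¬ γ ≈ 0# → ¬ δ ≈ 0# →
                  snoc v γ ≋ snoc w δ → m ≡ n × γ ≈ δ
  snoc-≋-degree []ᵛ       []ᵛ       γ≉0 δ≉0 h = ≡.refl , ≋-head h
  snoc-≋-degree []ᵛ       (y ∷ᵛ w) γ≉0 δ≉0 h = ⊥-elim (δ≉0 ([]≋snoc⇒≈0 w (≋-tail h)))
  snoc-≋-degree (x ∷ᵛ v) []ᵛ       γ≉0 δ≉0 h = ⊥-elim (γ≉0 ([]≋snoc⇒≈0 v (≋-sym (≋-tail h))))
  snoc-≋-degree (x ∷ᵛ v) (y ∷ᵛ w) γ≉0 δ≉0 h with snoc-≋-degree v w γ≉0 δ≉0 (≋-tail h)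
  ... | m≡n , γ≈δ = ≡.cong suc m≡n , γ≈δ

  addP-snoc : ∀ {m} p (v : Vec Carrier m) δ → length p ≤ m → ∃ λ (w : Vec Carrier m) → addP p (snoc v δ) ≋ snoc w δ
  addP-snoc []      v         δ _         = v , ≋-refl
  addP-snoc (a ∷ p) (x ∷ᵛ v) δ (s≤s p≤m) with addP-snoc p v δ p≤m
  ... | w , h = (a + x) ∷ᵛ w , ∷-cong refl h

  scale-snoc : ∀ {n} a (v : Vec Carrier n) γ → scale a (snoc v γ) ≡ snoc (Vec.map (a *_) v) (a * γ)
  scale-snoc a []ᵛ       γ = ≡.refl
  scale-snoc a (x ∷ᵛ v) γ = ≡.cong (a * x ∷_) (scale-snoc a v γ)

  length-scale-snoc : ∀ {k} a (v : Vec Carrier k) β → length (scale a (snoc v β)) ≡ suc k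
  length-scale-snoc a v β = ≡.trans (List.length-map (a *_) (snoc v β)) (length-snoc v β)

  mulP-snoc : ∀ {j k} (u : Vec Carrier j) (v : Vec Carrier k) α β →
              ∃ λ (w : Vec Carrier (j ℕ.+ k)) → mulP (snoc u α) (snoc v β) ≋ snoc w (α * β)
  mulP-snoc []ᵛ v α β =
    Vec.map (α *_) v , ≋-trans (addP-identityʳ (0∷-≋[] refl ≋-refl)) (≋-reflexive (scale-snoc α v β))
  mulP-snoc {suc j} {k} (x ∷ᵛ u) v α β with mulP-snoc u v α β
  ... | w′ , h with addP-snoc (scale x (snoc v β)) (0# ∷ᵛ w′) (α * β) length≤
    where
    length≤ : length (scale x (snoc v β)) ≤ suc (j ℕ.+ k)
    length≤ = ℕ.≤-trans (ℕ.≤-reflexive (length-scale-snoc x v β)) (s≤s (ℕ.m≤n+m k j))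
  ... | w , g = w , ≋-trans (addP-congʳ (scale x (snoc v β)) (∷-cong refl h)) g

  record LeadingForm (p : Poly) : Set where
    constructor leadingForm
    field
      {degree}      : ℕ
      degree<length : degree < length p
      lower         : Vec Carrier degree
      lead          : Carrier
      lead≉0        : ¬ lead ≈ 0#
      ≋snoc         : p ≋ snoc lower lead

  zero-or-leadingForm : ∀ p → p ≋ [] ⊎ LeadingForm p
  zero-or-leadingForm [] = inj₁ ≋-refl
  zero-or-leadingForm (a ∷ p) with zero-or-leadingForm p
  ... | inj₂ (leadingForm lt v c c≉0 h) = inj₂ (leadingForm (s≤s lt) (a ∷ᵛ v) c c≉0 (∷-cong refl h))
  ... | inj₁ p≋[] with a ≟ 0#
  ...   | yes a≈0 = inj₁ (0∷-≋[] a≈0 p≋[])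
  ...   | no  a≉0 = inj₂ (leadingForm (s≤s z≤n) []ᵛ a a≉0 (∷-cong refl p≋[]))

  monicMultiple : ∀ {p} (L : LeadingForm p) → ∃ λ c → scale c p ≋ monic (Vec.map (c *_) (LeadingForm.lower L))
  monicMultiple (leadingForm _ v c c≉0 h) with inverse c c≉0
  ... | c⁻¹ , cc⁻¹≈1 = c⁻¹ , ≋-trans (scale-congʳ c⁻¹ h)
    (≋-trans (≋-reflexive (scale-snoc c⁻¹ v c)) (snoc-cong ≋-refl (trans (*-comm c⁻¹ c) cc⁻¹≈1)))

  record Division {d} (m : Vec Carrier d) (a : Poly) : Set where
    constructor division
    field
      quotient  : Poly
      remainder : Vec Carrier d
      ≋divMod   : a ≋ addP (mulP (monic m) quotient) (toList remainder)

  reduce : ∀ {d} (m : Vec Carrier d) → Vec Carrier d → Carrier → Vec Carrier d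
  reduce m v l = Vec.zipWith (λ y c → - (l * c) + y) v m

  snoc-reduce : ∀ {d} (m v : Vec Carrier d) l → snoc v l ≋ addP (scale l (monic m)) (toList (reduce m v l))
  snoc-reduce []ᵛ       []ᵛ       l = ∷-cong (sym (*-identityʳ l)) ≋-refl
  snoc-reduce (c ∷ᵛ m) (y ∷ᵛ v) l = ∷-cong (sym (\\-leftDividesˡ (l * c) y)) (snoc-reduce m v l)

  divide : ∀ {d} (m : Vec Carrier d) (a : Poly) → Division m a
  divide {d} m [] = division [] (Vec.replicate d 0#)
    (≋-sym (≋-trans (addP-identityʳ (replicate-0≋[] d)) (mulP-zeroʳ (monic m) ≋-refl)))
    where
    replicate-0≋[] : ∀ n → toList (Vec.replicate n 0#) ≋ []
    replicate-0≋[] zero    = ≋-refl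
    replicate-0≋[] (suc n) = 0∷-≋[] refl (replicate-0≋[] n)
  divide m (a ∷ p) with divide m p | initLast (a ∷ᵛ Division.remainder (divide m p))
  ... | division c r h | v , l , a∷r≡v∷ʳl = division (l ∷ c) (reduce m v l) (begin
    a ∷ p                                              ≈⟨ ∷-cong (sym (+-identityˡ a)) h ⟩
    addP (0# ∷ mulP M c) (a ∷ toList r)                ≈⟨ addP-congʳ (0# ∷ mulP M c) (≋-reflexive a∷r≡snoc) ⟩
    addP (0# ∷ mulP M c) (snoc v l)                    ≈⟨ addP-congʳ (0# ∷ mulP M c) (snoc-reduce m v l) ⟩
    addP (0# ∷ mulP M c) (addP (scale l M) R)          ≈⟨ addP-leftComm (0# ∷ mulP M c) (scale l M) R ⟩
    addP (scale l M) (addP (0# ∷ mulP M c) R)          ≈⟨ addP-assoc (scale l M) (0# ∷ mulP M c) R ⟨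
    addP (addP (scale l M) (0# ∷ mulP M c)) R          ≈⟨ addP-congˡ R (mulP-consʳ M l c) ⟨
    addP (mulP M (l ∷ c)) R                            ∎)
    where
    open ≋-Reasoning
    M = monic m
    R = toList (reduce m v l)
    a∷r≡snoc : a ∷ toList r ≡ snoc v l
    a∷r≡snoc = ≡.trans (≡.cong toList a∷r≡v∷ʳl) (Vec.toList-∷ʳ l v)

  -- Euclid's lemma and distinct irreducible divisors
  infix 4 _∣ₚ_
  _∣ₚ_ : Poly → Poly → Set
  p ∣ₚ a = ∃ λ c → a ≋ mulP p c

  ∣ₚ-respʳ : ∀ {p a a′} → a ≋ a′ → p ∣ₚ a → p ∣ₚ a′
  ∣ₚ-respʳ a≋a′ (c , h) = c , ≋-trans (≋-sym a≋a′) h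

  record IsIrreducible {d} (p : Vec Carrier d) : Set where
    field
      positive      : 0 < d
      noMonicFactor : ∀ {k} (x : Vec Carrier k) c → 0 < k → k < d → ¬ monic p ≋ mulP (monic x) c

  1≉0 : ¬ 1# ≈ 0#
  1≉0 1≈0 = 0≉1 (sym 1≈0)

  monic-cofactor : ∀ {k e} (x : Vec Carrier k) (y : Vec Carrier e) → monic x ∣ₚ monic y →
                   ∃ λ j → Σ (Vec Carrier j) λ c → k ℕ.+ j ≡ e × monic y ≋ mulP (monic x) (monic c)
  monic-cofactor x y (c , h) with zero-or-leadingForm c
  ... | inj₁ c≋[] = ⊥-elim (1≉0 ([]≋snoc⇒≈0 y (≋-sym (≋-trans h (mulP-zeroʳ (monic x) c≋[])))))
  ... | inj₂ (leadingForm {j} _ v β β≉0 c≋) with mulP-snoc x v 1# β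
  ...   | w , xc≋ with snoc-≋-degree y w 1≉0 (λ 1β≈0 → β≉0 (trans (sym (*-identityˡ β)) 1β≈0))
                         (≋-trans h (≋-trans (mulP-congʳ (monic x) c≋) xc≋))
  ...     | e≡k+j , 1≈1β = j , v , ≡.sym e≡k+j ,
      ≋-trans h (mulP-congʳ (monic x) (≋-trans c≋ (snoc-cong ≋-refl (sym (trans 1≈1β (*-identityˡ β))))))

  -- The x with P ∣ x·b form an ideal containing P. Dividing P by a monic element of smaller degree
  -- leaves a remainder in the ideal, so descending on the degree reaches the monic 1, that is, P ∣ b.
  module Euclid {d} (p : Vec Carrier d) (irr : IsIrreducible p) (b : Poly) where
    P : Poly
    P = monic p

    record InIdeal (x : Poly) : Set where
      constructor inIdeal
      field
        cofactor  : Poly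
        ≋multiple : mulP x b ≋ mulP P cofactor

    P-inIdeal : InIdeal P
    P-inIdeal = inIdeal b ≋-refl

    addP-inIdeal : ∀ {x y} → InIdeal x → InIdeal y → InIdeal (addP x y)
    addP-inIdeal {x} {y} (inIdeal c h) (inIdeal c′ h′) = inIdeal (addP c c′)
      (≋-trans (mulP-distribʳ x y b) (≋-trans (addP-cong h h′) (≋-sym (mulP-distribˡ P c c′))))

    scale-inIdeal : ∀ {x} a → InIdeal x → InIdeal (scale a x)
    scale-inIdeal {x} a (inIdeal c h) = inIdeal (scale a c)
      (≋-trans (mulP-scaleˡ a x b) (≋-trans (scale-congʳ a h) (≋-sym (mulP-scaleʳ a P c))))

    mulP-inIdeal : ∀ {x} z → InIdeal x → InIdeal (mulP x z)
    mulP-inIdeal {x} z (inIdeal c h) = inIdeal (mulP c z) (begin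
      mulP (mulP x z) b   ≈⟨ mulP-assoc x z b ⟩
      mulP x (mulP z b)   ≈⟨ mulP-congʳ x (mulP-comm z b) ⟩
      mulP x (mulP b z)   ≈⟨ mulP-assoc x b z ⟨
      mulP (mulP x b) z   ≈⟨ mulP-congˡ z h ⟩
      mulP (mulP P c) z   ≈⟨ mulP-assoc P c z ⟩
      mulP P (mulP c z)   ∎)
      where open ≋-Reasoning

    inIdeal-resp : ∀ {x y} → x ≋ y → InIdeal x → InIdeal y
    inIdeal-resp x≋y (inIdeal c h) = inIdeal c (≋-trans (mulP-congˡ b (≋-sym x≋y)) h)

    remainder-inIdeal : ∀ {a y r} → InIdeal a → InIdeal y → a ≋ addP y r → InIdeal r
    remainder-inIdeal {a} {y} {r} a∈I y∈I a≋y+r =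
      inIdeal-resp r≋a-y (addP-inIdeal a∈I (scale-inIdeal (- 1#) y∈I))
      where
      open ≋-Reasoning
      r≋a-y : addP a (scale (- 1#) y) ≋ r
      r≋a-y = begin
        addP a (scale (- 1#) y)              ≈⟨ addP-congˡ (scale (- 1#) y) a≋y+r ⟩
        addP (addP y r) (scale (- 1#) y)     ≈⟨ addP-congˡ (scale (- 1#) y) (addP-comm y r) ⟩
        addP (addP r y) (scale (- 1#) y)     ≈⟨ addP-assoc r y (scale (- 1#) y) ⟩
        addP r (addP y (scale (- 1#) y))     ≈⟨ addP-identityʳ (addP-inverseʳ y) ⟩
        r                                    ∎

    monic-inIdeal : ∀ {r} (L : LeadingForm r) → InIdeal r →
                    Σ (Vec Carrier (LeadingForm.degree L)) λ x → InIdeal (monic x)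
    monic-inIdeal L r∈I with monicMultiple L
    ... | c , cr≋monic = _ , inIdeal-resp cr≋monic (scale-inIdeal c r∈I)

    smallerMonic-inIdeal : ∀ {a k} (x : Vec Carrier k) → InIdeal a → InIdeal (monic x) →
                           (r : Division x a) → LeadingForm (toList (Division.remainder r)) →
                           ∃ λ j → j < k × Σ (Vec Carrier j) λ x′ → InIdeal (monic x′)
    smallerMonic-inIdeal {k = k} x a∈I x∈I (division c r h) L =
      LeadingForm.degree L , j<k , monic-inIdeal L (remainder-inIdeal a∈I (mulP-inIdeal c x∈I) h)
      where
      j<k : LeadingForm.degree L < k
      j<k = ≡.subst (LeadingForm.degree L <_) (Vec.length-toList r) (LeadingForm.degree<length L)

    descent : ∀ {k} → Acc _<_ k → k < d → (x : Vec Carrier k) → InIdeal (monic x) → P ∣ₚ b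
    descent _ _ []ᵛ (inIdeal c h) = c , ≋-trans (≋-sym (mulP-identityˡ b)) h
    descent {suc k} (acc smaller) k<d x x∈I with divide x P
    ... | division c r P≋xc+r with zero-or-leadingForm (toList r)
    ...   | inj₁ r≋[] = ⊥-elim (IsIrreducible.noMonicFactor irr x c (s≤s z≤n) k<d
                                  (≋-trans P≋xc+r (addP-identityʳ r≋[])))
    ...   | inj₂ L with smallerMonic-inIdeal x P-inIdeal x∈I (division c r P≋xc+r) L
    ...     | j , j<k , x′ , x′∈I = descent (smaller j<k) (ℕ.<-trans j<k k<d) x′ x′∈I

    euclidsLemma : ∀ a → P ∣ₚ mulP a b → P ∣ₚ a ⊎ P ∣ₚ b
    euclidsLemma a (c , ab≋Pc) with divide p a
    ... | division q r a≋Pq+r with zero-or-leadingForm (toList r)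
    ...   | inj₁ r≋[] = inj₁ (q , ≋-trans a≋Pq+r (addP-identityʳ r≋[]))
    ...   | inj₂ L with smallerMonic-inIdeal p (inIdeal {a} c ab≋Pc) P-inIdeal (division q r a≋Pq+r) L
    ...     | j , j<d , x , x∈I = inj₂ (descent (<-wellFounded j) j<d x x∈I)

  open Euclid using (euclidsLemma)

  Monic : Set
  Monic = Σ ℕ (Vec Carrier)

  toMonic : ∀ {d} → Vec Carrier d → Monic
  toMonic r = _ , r

  poly : Monic → Poly
  poly (_ , v) = monic v

  Irreducible : Monic → Set
  Irreducible (_ , v) = IsIrreducible v

  Distinct : Monic → Monic → Set
  Distinct f g = ¬ poly f ≋ poly g

  irreducible-∤ : ∀ {f g} → Irreducible f → Irreducible g → Distinct f g → ¬ poly g ∣ₚ poly f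
  irreducible-∤ {d , r} {d′ , r′} irr irr′ f≉g g∣f with monic-cofactor r′ r g∣f
  ... | zero  , []ᵛ , _     , r≋r′c = f≉g (≋-trans r≋r′c (mulP-identityʳ (monic r′)))
  ... | suc j , c   , d′+j≡d , r≋r′c =
    IsIrreducible.noMonicFactor irr r′ (monic c) (IsIrreducible.positive irr′) d′<d r≋r′c
    where
    d′<d : d′ < d
    d′<d = ≡.subst (d′ <_) (≡.trans (≡.sym (ℕ.+-suc d′ j)) d′+j≡d) (s≤s (ℕ.m≤m+n d′ j))

  cancel-irreducible : ∀ {f c} → Irreducible f → ∀ gs → All Irreducible gs → All (Distinct f) gs →
                       All (λ g → poly g ∣ₚ mulP (poly f) c) gs → All (λ g → poly g ∣ₚ c) gs
  cancel-irreducible irr [] [] [] [] = []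
  cancel-irreducible {f} {c} irr (g ∷ gs) (irr′ ∷ irrs) (f≉g ∷ f≉gs) (g∣fc ∷ gs∣fc)
    with euclidsLemma (proj₂ g) irr′ c (poly f) g∣fc
  ... | inj₁ g∣f = ⊥-elim (irreducible-∤ irr irr′ f≉g g∣f)
  ... | inj₂ g∣c = g∣c ∷ cancel-irreducible irr gs irrs f≉gs gs∣fc

  sum-degrees-of-irreducible-divisors : ∀ {e} (y : Vec Carrier e) fs → All Irreducible fs →
    AllPairs Distinct fs → All (λ f → poly f ∣ₚ monic y) fs → sumℕ (List.map proj₁ fs) ≤ e
  sum-degrees-of-irreducible-divisors y [] _ _ _ = z≤n
  sum-degrees-of-irreducible-divisors y ((d , r) ∷ fs) (irr ∷ irrs) (f≉fs ∷ distinct) (f∣y ∷ fs∣y)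
    with monic-cofactor r y f∣y
  ... | j , c , d+j≡e , y≋rc =
    ≡.subst (d ℕ.+ sumℕ (List.map proj₁ fs) ≤_) d+j≡e
      (ℕ.+-monoʳ-≤ d (sum-degrees-of-irreducible-divisors c fs irrs distinct
        (cancel-irreducible irr fs irrs f≉fs (All.map (λ {f} → ∣ₚ-respʳ {poly f} y≋rc) fs∣y))))

  length-vecs : ∀ d → length (vecs d) ≡ q ^ d
  length-vecs zero    = ≡.refl
  length-vecs (suc d) = ≡.trans
    (length-concatMap-const (λ x → map (x ∷ᵛ_) (vecs d)) (λ x → List.length-map (x ∷ᵛ_) (vecs d)) elements)
    (≡.cong (q ℕ.*_) (length-vecs d))

  vecs-complete : ∀ {d} (v : Vec Carrier d) → ∃ λ r → r ∈ vecs d × toList r ≋ toList v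
  vecs-complete []ᵛ = []ᵛ , Any.here ≡.refl , ≋-refl
  vecs-complete {suc d} (x ∷ᵛ v) with find (complete x) | vecs-complete v
  ... | y , y∈elements , x≈y | r , r∈vecs , r≋v =
    y ∷ᵛ r , ∈-concatMap⁺ (λ x → map (x ∷ᵛ_) (vecs d)) (lose y∈elements (∈-map⁺ (y ∷ᵛ_) r∈vecs)) ,
    ∷-cong (sym x≈y) r≋v

  vecs-distinct : ∀ d → AllPairs (λ r r′ → ¬ toList r ≋ toList r′) (vecs d)
  vecs-distinct zero    = All.[] ∷ []
  vecs-distinct (suc d) = AllPairs-concatMap⁺ (λ x → map (x ∷ᵛ_) (vecs d))
    (λ x → AllPairs.map⁺ (AllPairs.map (λ r≉r′ → r≉r′ ∘ ≋-tail) (vecs-distinct d)))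
    (AllPairs.map (λ x≉y {u} {v} u∈ v∈ → differentHeads x≉y (∈-map⁻ _ u∈) (∈-map⁻ _ v∈)) distinct)
    where
    differentHeads : ∀ {x y u v} → ¬ x ≈ y →
                     ∃ (λ r → r ∈ vecs d × u ≡ x ∷ᵛ r) → ∃ (λ r → r ∈ vecs d × v ≡ y ∷ᵛ r) → ¬ toList u ≋ toList v
    differentHeads x≉y (_ , _ , ≡.refl) (_ , _ , ≡.refl) = x≉y ∘ ≋-head

  eqP-sound : ∀ p r → T (eqP p r) → p ≋ r
  eqP-sound []      []      _ = ≋-refl
  eqP-sound (a ∷ p) (b ∷ r) h with a ≟ b
  ... | yes a≈b = ∷-cong a≈b (eqP-sound p r h)

  eqP-complete : ∀ p r → p ≋ r → length p ≡ length r → T (eqP p r)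
  eqP-complete []      []      _ _ = _
  eqP-complete (a ∷ p) (b ∷ r) h e with a ≟ b
  ... | yes _   = eqP-complete p r (≋-tail h) (ℕ.suc-injective e)
  ... | no  a≉b = a≉b (≋-head h)

  length-addP : ∀ p r → length (addP p r) ≡ length p ⊔ length r
  length-addP []      r       = ≡.refl
  length-addP (a ∷ p) []      = ≡.refl
  length-addP (a ∷ p) (b ∷ r) = ≡.cong suc (length-addP p r)

  length-mulP-snoc : ∀ {j k} (u : Vec Carrier j) (v : Vec Carrier k) α β →
                     length (mulP (snoc u α) (snoc v β)) ≡ suc (j ℕ.+ k)
  length-mulP-snoc {k = k} []ᵛ v α β = begin
    length (addP (scale α (snoc v β)) [ 0# ])  ≡⟨ length-addP (scale α (snoc v β)) [ 0# ] ⟩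
    length (scale α (snoc v β)) ⊔ 1            ≡⟨ ≡.cong (_⊔ 1) (length-scale-snoc α v β) ⟩
    suc k ⊔ 1                                  ≡⟨ ℕ.m≥n⇒m⊔n≡m (s≤s z≤n) ⟩
    suc k                                      ∎
    where open ≡.≡-Reasoning
  length-mulP-snoc {suc j} {k} (x ∷ᵛ u) v α β = begin
    length (addP (scale x (snoc v β)) (0# ∷ mulP (snoc u α) (snoc v β)))
      ≡⟨ length-addP (scale x (snoc v β)) _ ⟩
    length (scale x (snoc v β)) ⊔ suc (length (mulP (snoc u α) (snoc v β)))
      ≡⟨ ≡.cong₂ (λ m n → m ⊔ suc n) (length-scale-snoc x v β) (length-mulP-snoc u v α β) ⟩
    suc k ⊔ suc (suc (j ℕ.+ k))
      ≡⟨ ℕ.m≤n⇒m⊔n≡n (s≤s (ℕ.m≤n⇒m≤1+n (ℕ.m≤n+m k j))) ⟩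
    suc (suc (j ℕ.+ k)) ∎
    where open ≡.≡-Reasoning

  divides?-sound : ∀ {k e} (x : Vec Carrier k) (y : Vec Carrier e) →
                   T (divides? k e (monic x) (monic y)) → monic x ∣ₚ monic y
  divides?-sound {k} {e} x y h
    with find (Any.any⁻ _ (vecs (e ∸ k)) (proj₂ (Equivalence.to T-∧ h)))
  ... | r , _ , xr≟y = monic r , ≋-sym (eqP-sound _ _ xr≟y)

  divides?-complete : ∀ {k j e} (x : Vec Carrier k) (y : Vec Carrier e) (c : Vec Carrier j) → k ℕ.+ j ≡ e →
                      monic y ≋ mulP (monic x) (monic c) → T (divides? k e (monic x) (monic y))
  divides?-complete {k} {j} x y c ≡.refl y≋xc with vecs-complete c
  ... | c′ , c′∈vecs , c′≋c = Equivalence.from T-∧ (ℕ.≤⇒≤ᵇ (ℕ.m≤m+n k j) ,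
    ≡.subst (λ n → T (any (λ (r : Vec Carrier n) → eqP (mulP (monic x) (monic r)) (monic y)) (vecs n)))
            (≡.sym (ℕ.m+n∸m≡n k j))
            (Any.any⁺ _ (lose c′∈vecs (eqP-complete _ _ xc′≋y length-xc′≡length-y))))
    where
    xc′≋y : mulP (monic x) (monic c′) ≋ monic y
    xc′≋y = ≋-sym (≋-trans y≋xc (mulP-congʳ (monic x) (snoc-cong (≋-sym c′≋c) refl)))
    length-xc′≡length-y : length (mulP (monic x) (monic c′)) ≡ length (monic y)
    length-xc′≡length-y = ≡.trans (length-mulP-snoc x c′ 1# 1#) (≡.sym (length-snoc y 1#))

  irreducible?-sound : ∀ {d} (p : Vec Carrier d) → T (irreducible? d (monic p)) → IsIrreducible p
  irreducible?-sound {d} p h = record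
    { positive      = ℕ.≤ᵇ⇒≤ 1 d (proj₁ (Equivalence.to T-∧ h))
    ; noMonicFactor = noMonicFactor
    }
    where
    noMonicFactor : ∀ {k} (x : Vec Carrier k) c → 0 < k → k < d → ¬ monic p ≋ mulP (monic x) c
    noMonicFactor {suc k} x c _ k<d p≋xc with monic-cofactor x p (c , p≋xc) | vecs-complete x
    ... | j , c′ , k+j≡d , p≋xc′ | x′ , x′∈vecs , x′≋x =
      ≡.subst T (Equivalence.to T-not-≡ noDivisorOfDegree) (divides?-complete x′ p c′ k+j≡d
        (≋-trans p≋xc′ (mulP-congˡ (monic c′) (snoc-cong (≋-sym x′≋x) refl))))
      where
      noDivisorOfDegree : T (not (divides? (suc k) d (monic x′) (monic p)))
      noDivisorOfDegree = All.lookup (All.all⁺ _ (vecs (suc k))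
        (All.lookup (All.all⁺ _ (upTo d) (proj₂ (Equivalence.to T-∧ h))) (∈-upTo⁺ k<d))) x′∈vecs

  module _ {e} (y : Vec Carrier e) where

    isIrreducibleDivisor : (d : ℕ) → Vec Carrier d → Bool
    isIrreducibleDivisor d r = irreducible? d (monic r) ∧ divides? d e (monic r) (monic y)

    irreducibleDivisor? : ∀ d → Decidable (T ∘ isIrreducibleDivisor d)
    irreducibleDivisor? d r = T? (isIrreducibleDivisor d r)

    irreducibleDivisorCount : ℕ → ℕ
    irreducibleDivisorCount d = countB (isIrreducibleDivisor d) (vecs d)

    irreducibleDivisorCount≤q^d : ∀ d → irreducibleDivisorCount d ≤ q ^ d
    irreducibleDivisorCount≤q^d d = begin
      irreducibleDivisorCount d                        ≡⟨ countB≡length-filter (isIrreducibleDivisor d) (vecs d) ⟩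
      length (filter (irreducibleDivisor? d) (vecs d)) ≤⟨ List.length-filter (irreducibleDivisor? d) (vecs d) ⟩
      length (vecs d)                                  ≡⟨ length-vecs d ⟩
      q ^ d                                            ∎
      where open ℕ.≤-Reasoning

    irreducibleDivisorsOfDegree : ℕ → List Monic
    irreducibleDivisorsOfDegree d = map toMonic (filter (irreducibleDivisor? d) (vecs d))

    irreducibleDivisors : List Monic
    irreducibleDivisors = concatMap irreducibleDivisorsOfDegree (upTo (suc e))

    ∈-irreducibleDivisors⁻ : ∀ {f} → f ∈ irreducibleDivisors → Irreducible f × poly f ∣ₚ monic y
    ∈-irreducibleDivisors⁻ f∈ with find (∈-concatMap⁻ irreducibleDivisorsOfDegree {xs = upTo (suc e)} f∈)
    ... | d , _ , f∈ᵈ with ∈-map⁻ _ f∈ᵈ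
    ...   | r , r∈ , ≡.refl with Equivalence.to T-∧ (proj₂ (∈-filter⁻ (irreducibleDivisor? d) {xs = vecs d} r∈))
    ...     | irr , r∣y = irreducible?-sound r irr , divides?-sound r y r∣y

    irreducibleDivisors-distinct : AllPairs Distinct irreducibleDivisors
    irreducibleDivisors-distinct = AllPairs-concatMap⁺ irreducibleDivisorsOfDegree distinctOfDegree
      (AllPairs.map (λ d≢d′ {f} {g} f∈ g∈ → differentDegrees d≢d′ (∈-map⁻ _ f∈) (∈-map⁻ _ g∈)) (Unique.upTo⁺ (suc e)))
      where
      distinctOfDegree : ∀ d → AllPairs Distinct (irreducibleDivisorsOfDegree d)
      distinctOfDegree d = AllPairs.map⁺ (AllPairs.map (λ {r} {r′} r≉r′ → r≉r′ ∘ snoc-injective r r′)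
        (AllPairs.filter⁺ (irreducibleDivisor? d) (vecs-distinct d)))
      differentDegrees : ∀ {d d′ f g} → ¬ d ≡ d′ →
        ∃ (λ (r : Vec Carrier d) → r ∈ filter (irreducibleDivisor? d) (vecs d) × f ≡ toMonic r) →
        ∃ (λ (r : Vec Carrier d′) → r ∈ filter (irreducibleDivisor? d′) (vecs d′) × g ≡ toMonic r) → Distinct f g
      differentDegrees d≢d′ (r , _ , ≡.refl) (r′ , _ , ≡.refl) f≋g = d≢d′ (proj₁ (snoc-≋-degree r r′ 1≉0 1≉0 f≋g))

    sum-degrees-toMonic : ∀ d (rs : List (Vec Carrier d)) → sumℕ (map proj₁ (map toMonic rs)) ≡ d ℕ.* length rs
    sum-degrees-toMonic d []       = ≡.sym (ℕ.*-zeroʳ d)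
    sum-degrees-toMonic d (r ∷ rs) = ≡.trans (≡.cong (d ℕ.+_) (sum-degrees-toMonic d rs)) (≡.sym (ℕ.*-suc d (length rs)))

    weighted-irreducibleDivisorCount≤degree : sumUpTo (λ d → d ℕ.* irreducibleDivisorCount d) (suc e) ≤ e
    weighted-irreducibleDivisorCount≤degree = ≡.subst (_≤ e) sum-degrees
      (sum-degrees-of-irreducible-divisors y irreducibleDivisors
        (All.tabulate (proj₁ ∘ ∈-irreducibleDivisors⁻)) irreducibleDivisors-distinct
        (All.tabulate (proj₂ ∘ ∈-irreducibleDivisors⁻)))
      where
      open ≡.≡-Reasoning
      sum-degrees : sumℕ (map proj₁ irreducibleDivisors) ≡ sumUpTo (λ d → d ℕ.* irreducibleDivisorCount d) (suc e)
      sum-degrees = begin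
        sumℕ (map proj₁ irreducibleDivisors)
          ≡⟨ sum-map-concatMap irreducibleDivisorsOfDegree proj₁ (upTo (suc e)) ⟩
        sumℕ (map (λ d → sumℕ (map proj₁ (irreducibleDivisorsOfDegree d))) (upTo (suc e)))
          ≡⟨ ≡.cong sumℕ (List.map-cong (λ d → ≡.trans (sum-degrees-toMonic d (filter (irreducibleDivisor? d) (vecs d)))
               (≡.cong (d ℕ.*_) (≡.sym (countB≡length-filter (isIrreducibleDivisor d) (vecs d))))) (upTo (suc e))) ⟩
        sumUpTo (λ d → d ℕ.* irreducibleDivisorCount d) (suc e) ∎

-- Bounding ω
module _ where
  open import Data.Nat using (_+_; _*_; _⊓_; >-nonZero⁻¹)
  open import Data.Nat.Properties
  open import Data.Nat.DivMod using (_/_; _%_; m≡m%n+[m/n]*n; m%n<n; m/n*n≤m)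

  -- Each of the at most t + 1 degrees d ≤ t contributes (t + 1) c d ≤ (t + 1) q ^ t, and each degree
  -- d > t contributes (t + 1) c d ≤ d c d.
  weighted-count : ∀ (c : ℕ → ℕ) q t .{{_ : NonZero q}} → (∀ d → c d ≤ q ^ d) → ∀ N →
    suc t * sumUpTo c N ≤ suc t * (N ⊓ suc t) * q ^ t + sumUpTo (λ d → d * c d) N
  weighted-count c q t c≤q^ zero = ≤-trans (≤-reflexive (*-zeroʳ (suc t))) z≤n
  weighted-count c q t c≤q^ (suc N) with ≤-<-connex N t
  ... | inj₁ N≤t = begin
    suc t * sumUpTo c (suc N)                         ≡⟨ ≡.cong (suc t *_) (sumUpTo-suc c N) ⟩
    suc t * (sumUpTo c N + c N)                       ≡⟨ *-distribˡ-+ (suc t) (sumUpTo c N) (c N) ⟩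
    suc t * sumUpTo c N + suc t * c N                 ≤⟨ +-mono-≤ (weighted-count c q t c≤q^ N)
                                                           (*-monoʳ-≤ (suc t) (≤-trans (c≤q^ N) (^-monoʳ-≤ q N≤t))) ⟩
    suc t * (N ⊓ suc t) * q ^ t + W + suc t * q ^ t   ≡⟨ ≡.cong (λ m → suc t * m * q ^ t + W + suc t * q ^ t)
                                                           (m≤n⇒m⊓n≡m (m≤n⇒m≤1+n N≤t)) ⟩
    suc t * N * q ^ t + W + suc t * q ^ t             ≡⟨ solve 4 (λ T N Q W → T :* N :* Q :+ W :+ T :* Q
                                                                           := T :* (con 1 :+ N) :* Q :+ W)
                                                                 ≡.refl (suc t) N (q ^ t) W ⟩
    suc t * suc N * q ^ t + W                         ≡⟨ ≡.cong (λ m → suc t * m * q ^ t + W) (m≤n⇒m⊓n≡m (s≤s N≤t)) ⟨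
    suc t * (suc N ⊓ suc t) * q ^ t + W               ≤⟨ +-monoʳ-≤ (suc t * (suc N ⊓ suc t) * q ^ t) (m≤m+n W (N * c N)) ⟩
    suc t * (suc N ⊓ suc t) * q ^ t + (W + N * c N)   ≡⟨ ≡.cong (suc t * (suc N ⊓ suc t) * q ^ t +_)
                                                           (sumUpTo-suc (λ d → d * c d) N) ⟨
    suc t * (suc N ⊓ suc t) * q ^ t + sumUpTo (λ d → d * c d) (suc N) ∎
    where open ≤-Reasoning
          W = sumUpTo (λ d → d * c d) N
  ... | inj₂ t<N = begin
    suc t * sumUpTo c (suc N)                         ≡⟨ ≡.cong (suc t *_) (sumUpTo-suc c N) ⟩
    suc t * (sumUpTo c N + c N)                       ≡⟨ *-distribˡ-+ (suc t) (sumUpTo c N) (c N) ⟩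
    suc t * sumUpTo c N + suc t * c N                 ≤⟨ +-mono-≤ (weighted-count c q t c≤q^ N) (*-monoˡ-≤ (c N) t<N) ⟩
    suc t * (N ⊓ suc t) * q ^ t + W + N * c N         ≡⟨ +-assoc (suc t * (N ⊓ suc t) * q ^ t) W (N * c N) ⟩
    suc t * (N ⊓ suc t) * q ^ t + (W + N * c N)       ≡⟨ ≡.cong₂ (λ m w → suc t * m * q ^ t + w)
                                                           (≡.trans (m≥n⇒m⊓n≡n t<N) (≡.sym (m≥n⇒m⊓n≡n (m≤n⇒m≤1+n t<N))))
                                                           (≡.sym (sumUpTo-suc (λ d → d * c d) N)) ⟩
    suc t * (suc N ⊓ suc t) * q ^ t + sumUpTo (λ d → d * c d) (suc N) ∎
    where open ≤-Reasoning
          W = sumUpTo (λ d → d * c d) N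

  count-bound : ∀ (c : ℕ → ℕ) q t e .{{_ : NonZero q}} → (∀ d → c d ≤ q ^ d) →
    sumUpTo (λ d → d * c d) (suc e) ≤ e → suc t * sumUpTo c (suc e) ≤ suc t * suc t * q ^ t + e
  count-bound c q t e c≤q^ weighted≤e = ≤-trans (weighted-count c q t c≤q^ (suc e))
    (+-mono-≤ (*-monoˡ-≤ (q ^ t) (*-monoʳ-≤ (suc t) (m⊓n≤n (suc e) (suc t)))) weighted≤e)

  module ExponentBound (a D : ℕ) .{{_ : NonZero D}} where

    t : ℕ
    t = 4 * a * D

    C : ℕ
    C = suc t * suc t * (2 ^ t) ^ t

    n₀ : ℕ
    n₀ = C + 4 * D

    suc-n≤D*[n/D]+D : ∀ n → suc n ≤ D * (n / D) + D
    suc-n≤D*[n/D]+D n = begin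
      suc n                   ≡⟨ ≡.cong suc (m≡m%n+[m/n]*n n D) ⟩
      suc (n % D) + n / D * D ≤⟨ +-monoˡ-≤ (n / D * D) (m%n<n n D) ⟩
      D + n / D * D           ≡⟨ solve 2 (λ D s → D :+ s :* D := D :* s :+ D) ≡.refl D (n / D) ⟩
      D * (n / D) + D         ∎
      where open ≤-Reasoning

    C+n+2≤4D[n/D] : ∀ {n} → n₀ ≤ n → C + suc (suc n) ≤ 4 * (D * (n / D))
    C+n+2≤4D[n/D] {n} n₀≤n = +-cancelʳ-≤ (4 * D) _ _ (begin
      C + suc (suc n) + 4 * D               ≡⟨ solve 3 (λ C n D → C :+ n :+ con 4 :* D := C :+ con 4 :* D :+ n)
                                                       ≡.refl C (suc (suc n)) D ⟩
      n₀ + suc (suc n)                      ≤⟨ +-monoˡ-≤ (suc (suc n)) n₀≤n ⟩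
      n + suc (suc n)                       ≤⟨ m≤m+n (n + suc (suc n)) (n + suc (suc n)) ⟩
      (n + suc (suc n)) + (n + suc (suc n)) ≡⟨ solve 1 (λ n → (n :+ (con 2 :+ n)) :+ (n :+ (con 2 :+ n))
                                                              := con 4 :* (con 1 :+ n)) ≡.refl n ⟩
      4 * suc n                             ≤⟨ *-monoʳ-≤ 4 (suc-n≤D*[n/D]+D n) ⟩
      4 * (D * (n / D) + D)                 ≡⟨ *-distribˡ-+ 4 (D * (n / D)) D ⟩
      4 * (D * (n / D)) + 4 * D             ∎)
      where open ≤-Reasoning

    j≤2⌈j/2⌉ : ∀ j → j ≤ 2 * ⌈ j /2⌉
    j≤2⌈j/2⌉ j = begin
      j                         ≡⟨ ⌊n/2⌋+⌈n/2⌉≡n j ⟨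
      ⌊ j /2⌋ + ⌈ j /2⌉         ≤⟨ +-monoˡ-≤ ⌈ j /2⌉ (⌊n/2⌋≤⌈n/2⌉ j) ⟩
      ⌈ j /2⌉ + ⌈ j /2⌉         ≡⟨ ≡.cong (⌈ j /2⌉ +_) (+-identityʳ ⌈ j /2⌉) ⟨
      2 * ⌈ j /2⌉               ∎
      where open ≤-Reasoning

    n+2+j≤4D[n/D+⌈j/2⌉] : ∀ {n} j → n₀ ≤ n → suc (suc (n + j)) ≤ 4 * D * (n / D + ⌈ j /2⌉)
    n+2+j≤4D[n/D+⌈j/2⌉] {n} j n₀≤n = begin
      suc (suc (n + j))             ≡⟨ solve 2 (λ n j → con 2 :+ (n :+ j) := (con 2 :+ n) :+ j) ≡.refl n j ⟩
      suc (suc n) + j               ≤⟨ +-mono-≤ (≤-trans (m≤n+m (suc (suc n)) C) (C+n+2≤4D[n/D] n₀≤n))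
                                                (≤-trans (j≤2⌈j/2⌉ j) (*-monoˡ-≤ u (*-monoʳ-≤ 2 1≤2D))) ⟩
      4 * (D * s) + 2 * (2 * D) * u ≡⟨ solve 3 (λ D s u → con 4 :* (D :* s) :+ con 2 :* (con 2 :* D) :* u
                                                      := con 4 :* D :* (s :+ u)) ≡.refl D s u ⟩
      4 * D * (s + u)               ∎
      where
      open ≤-Reasoning
      s = n / D
      u = ⌈ j /2⌉
      1≤2D : 1 ≤ 2 * D
      1≤2D = ≤-trans (>-nonZero⁻¹ D) (m≤n*m D 2)

    2^aw≤q^[n/D+⌈j/2⌉]-large : ∀ q → 2 ^ t ≤ q → ∀ {n} j w → n₀ ≤ n → w ≤ suc (suc (n + j)) →
                                 2 ^ (a * w) ≤ q ^ (n / D + ⌈ j /2⌉)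
    2^aw≤q^[n/D+⌈j/2⌉]-large q 2^t≤q {n} j w n₀≤n w≤n+j+2 = begin
      2 ^ (a * w)                 ≤⟨ ^-monoʳ-≤ 2 (*-monoʳ-≤ a (≤-trans w≤n+j+2 (n+2+j≤4D[n/D+⌈j/2⌉] j n₀≤n))) ⟩
      2 ^ (a * (4 * D * (s + u))) ≡⟨ ≡.cong (2 ^_) (solve 4 (λ a D s u → a :* (con 4 :* D :* (s :+ u))
                                                                       := con 4 :* a :* D :* (s :+ u)) ≡.refl a D s u) ⟩
      2 ^ (t * (s + u))           ≡⟨ ^-*-assoc 2 t (s + u) ⟨
      (2 ^ t) ^ (s + u)           ≤⟨ ^-monoˡ-≤ (s + u) 2^t≤q ⟩
      q ^ (s + u)                 ∎
      where
      open ≤-Reasoning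
      s = n / D
      u = ⌈ j /2⌉

    2^aw≤q^[n/D+⌈j/2⌉]-small : ∀ q → 2 ≤ q → q < 2 ^ t → ∀ {n} j w → n₀ ≤ n →
                                 suc t * w ≤ suc t * suc t * q ^ t + suc (n + j) → 2 ^ (a * w) ≤ q ^ (n / D + ⌈ j /2⌉)
    2^aw≤q^[n/D+⌈j/2⌉]-small q 2≤q q<2^t {n} j w n₀≤n [t+1]w≤ =
      ≤-trans (^-monoʳ-≤ 2 (*-cancelˡ-≤ (suc t) [t+1]aw≤[t+1][s+u])) (^-monoˡ-≤ (s + u) 2≤q)
      where
      open ≤-Reasoning
      s = n / D
      u = ⌈ j /2⌉
      2a≤t+1 : 2 * a ≤ suc t
      2a≤t+1 = ≤-trans (*-monoˡ-≤ a {2} {4} (s≤s (s≤s z≤n))) (≤-trans (m≤m*n (4 * a) D) (n≤1+n t))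
      [t+1]aw≤[t+1][s+u] : suc t * (a * w) ≤ suc t * (s + u)
      [t+1]aw≤[t+1][s+u] = begin
        suc t * (a * w)                 ≡⟨ solve 3 (λ T a w → T :* (a :* w) := a :* (T :* w)) ≡.refl (suc t) a w ⟩
        a * (suc t * w)                 ≤⟨ *-monoʳ-≤ a (≤-trans [t+1]w≤ (+-monoˡ-≤ (suc (n + j))
                                             (*-monoʳ-≤ (suc t * suc t) (^-monoˡ-≤ t (<⇒≤ q<2^t))))) ⟩
        a * (C + suc (n + j))           ≡⟨ solve 4 (λ a C n j → a :* (C :+ (con 1 :+ (n :+ j)))
                                                         := a :* (C :+ (con 1 :+ n)) :+ a :* j) ≡.refl a C n j ⟩
        a * (C + suc n) + a * j         ≤⟨ +-mono-≤ (*-monoʳ-≤ a (≤-trans (+-monoʳ-≤ C (n≤1+n (suc n))) (C+n+2≤4D[n/D] n₀≤n)))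
                                                    (*-monoʳ-≤ a (j≤2⌈j/2⌉ j)) ⟩
        a * (4 * (D * s)) + a * (2 * u) ≡⟨ solve 4 (λ a D s u → a :* (con 4 :* (D :* s)) :+ a :* (con 2 :* u)
                                                         := con 4 :* a :* D :* s :+ con 2 :* a :* u) ≡.refl a D s u ⟩
        t * s + 2 * a * u               ≤⟨ +-mono-≤ (*-monoˡ-≤ s (n≤1+n t)) (*-monoˡ-≤ u 2a≤t+1) ⟩
        suc t * s + suc t * u           ≡⟨ *-distribˡ-+ (suc t) s u ⟨
        suc t * (s + u)                 ∎

    -- For large q the trivial bound w ≤ n + j + 2 suffices; for q < 2 ^ t the (t + 1)-weighted count
    -- bounds w by (C + n + 1 + j) / (t + 1), which is small compared with n / D + j / 2.
    2^aw≤q^[n/D+⌈j/2⌉] : ∀ q → 2 ≤ q → ∀ {n} j w → n₀ ≤ n → w ≤ suc (suc (n + j)) →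
                           suc t * w ≤ suc t * suc t * q ^ t + suc (n + j) → 2 ^ (a * w) ≤ q ^ (n / D + ⌈ j /2⌉)
    2^aw≤q^[n/D+⌈j/2⌉] q 2≤q j w n₀≤n w≤n+j+2 [t+1]w≤ with ≤-<-connex (2 ^ t) q
    ... | inj₁ 2^t≤q = 2^aw≤q^[n/D+⌈j/2⌉]-large q 2^t≤q j w n₀≤n w≤n+j+2
    ... | inj₂ q<2^t = 2^aw≤q^[n/D+⌈j/2⌉]-small q 2≤q q<2^t j w n₀≤n [t+1]w≤

    [D∸k]*n≤[n∸n/D]*D : ∀ n {k} → 1 ≤ k → (D ∸ k) * n ≤ (n ∸ n / D) * D
    [D∸k]*n≤[n∸n/D]*D n {k} 1≤k = begin
      (D ∸ k) * n          ≤⟨ *-monoˡ-≤ n (∸-monoʳ-≤ D 1≤k) ⟩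
      (D ∸ 1) * n          ≡⟨ *-distribʳ-∸ n D 1 ⟩
      D * n ∸ 1 * n        ≡⟨ ≡.cong₂ _∸_ (*-comm D n) (*-identityˡ n) ⟩
      n * D ∸ n            ≤⟨ ∸-monoʳ-≤ (n * D) (m/n*n≤m n D) ⟩
      n * D ∸ n / D * D    ≡⟨ *-distribʳ-∸ D n (n / D) ⟨
      (n ∸ n / D) * D      ∎
      where open ≤-Reasoning

module _ where
  open import Data.Rational using (_+_; _*_)

  infix 7.5 _/ℕ_
  _/ℕ_ : ℕ → (b : ℕ) .{{_ : NonZero b}} → ℚ
  a /ℕ b = (ℤ.+ a) ℚ./ b

  toℚᵘ-/ℕ : ∀ a b .{{_ : NonZero b}} → toℚᵘ (a /ℕ b) ℚᵘ.≃ (ℤ.+ a) ℚᵘ./ b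
  toℚᵘ-/ℕ a (suc b) = ℚ.toℚᵘ-fromℚᵘ (ℚᵘ.mkℚᵘ (ℤ.+ a) b)

  /ℕ-mono-≤ : ∀ a b c d .{{_ : NonZero b}} .{{_ : NonZero d}} → a ℕ.* d ℕ.≤ c ℕ.* b → a /ℕ b ℚ.≤ c /ℕ d
  /ℕ-mono-≤ a b@(suc _) c d@(suc _) ad≤cb = ℚ.toℚᵘ-cancel-≤
    (ℚᵘ.≤-respˡ-≃ (ℚᵘ.≃-sym (toℚᵘ-/ℕ a b)) (ℚᵘ.≤-respʳ-≃ (ℚᵘ.≃-sym (toℚᵘ-/ℕ c d))
      (ℚᵘ.*≤* (≡.subst₂ ℤ._≤_ (ℤ.pos-* a d) (ℤ.pos-* c b) (ℤ.+≤+ ad≤cb)))))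

  /ℕ-+ : ∀ a b c d .{{_ : NonZero b}} .{{_ : NonZero d}} →
        a /ℕ b + c /ℕ d ≡ _/ℕ_ (a ℕ.* d ℕ.+ c ℕ.* b) (b ℕ.* d) {{ℕ.m*n≢0 b d}}
  /ℕ-+ a b@(suc _) c d@(suc _) = ℚ.toℚᵘ-injective (begin
    toℚᵘ (a /ℕ b + c /ℕ d)                         ≈⟨ ℚ.toℚᵘ-homo-+ (a /ℕ b) (c /ℕ d) ⟩
    toℚᵘ (a /ℕ b) ℚᵘ.+ toℚᵘ (c /ℕ d)               ≈⟨ ℚᵘ.+-cong (toℚᵘ-/ℕ a b) (toℚᵘ-/ℕ c d) ⟩
    ((ℤ.+ a) ℚᵘ./ b) ℚᵘ.+ ((ℤ.+ c) ℚᵘ./ d)           ≡⟨ ≡.cong (λ z → ℚᵘ.mkℚᵘ z _) numerator ⟩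
    (ℤ.+ (a ℕ.* d ℕ.+ c ℕ.* b)) ℚᵘ./ (b ℕ.* d)    ≈⟨ toℚᵘ-/ℕ (a ℕ.* d ℕ.+ c ℕ.* b) (b ℕ.* d) {{ℕ.m*n≢0 b d}} ⟨
    toℚᵘ (_/ℕ_ (a ℕ.* d ℕ.+ c ℕ.* b) (b ℕ.* d) {{ℕ.m*n≢0 b d}}) ∎)
    where
    open ℚᵘ.≃-Reasoning
    numerator : (ℤ.+ a) ℤ.* (ℤ.+ d) ℤ.+ (ℤ.+ c) ℤ.* (ℤ.+ b) ≡ ℤ.+ (a ℕ.* d ℕ.+ c ℕ.* b)
    numerator = ≡.trans (≡.cong₂ ℤ._+_ (≡.sym (ℤ.pos-* a d)) (≡.sym (ℤ.pos-* c b))) (≡.sym (ℤ.pos-+ (a ℕ.* d) (c ℕ.* b)))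

  /ℕ-* : ∀ a b c d .{{_ : NonZero b}} .{{_ : NonZero d}} → a /ℕ b * c /ℕ d ≡ _/ℕ_ (a ℕ.* c) (b ℕ.* d) {{ℕ.m*n≢0 b d}}
  /ℕ-* a b@(suc _) c d@(suc _) = ℚ.toℚᵘ-injective (begin
    toℚᵘ (a /ℕ b * c /ℕ d)                   ≈⟨ ℚ.toℚᵘ-homo-* (a /ℕ b) (c /ℕ d) ⟩
    toℚᵘ (a /ℕ b) ℚᵘ.* toℚᵘ (c /ℕ d)         ≈⟨ ℚᵘ.*-cong (toℚᵘ-/ℕ a b) (toℚᵘ-/ℕ c d) ⟩
    ((ℤ.+ a) ℚᵘ./ b) ℚᵘ.* ((ℤ.+ c) ℚᵘ./ d)     ≡⟨ ≡.cong (λ z → ℚᵘ.mkℚᵘ z _) (≡.sym (ℤ.pos-* a c)) ⟩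
    (ℤ.+ (a ℕ.* c)) ℚᵘ./ (b ℕ.* d)           ≈⟨ toℚᵘ-/ℕ (a ℕ.* c) (b ℕ.* d) {{ℕ.m*n≢0 b d}} ⟨
    toℚᵘ (_/ℕ_ (a ℕ.* c) (b ℕ.* d) {{ℕ.m*n≢0 b d}}) ∎)
    where open ℚᵘ.≃-Reasoning

  /ℕ-≡ : ∀ a b c d .{{_ : NonZero b}} .{{_ : NonZero d}} → a ℕ.* d ≡ c ℕ.* b → a /ℕ b ≡ c /ℕ d
  /ℕ-≡ a b c d ad≡cb =
    ℚ.≤-antisym (/ℕ-mono-≤ a b c d (ℕ.≤-reflexive ad≡cb)) (/ℕ-mono-≤ c d a b (ℕ.≤-reflexive (≡.sym ad≡cb)))

  /ℕ-+-sameDenominator : ∀ a c b .{{_ : NonZero b}} → a /ℕ b + c /ℕ b ≡ (a ℕ.+ c) /ℕ b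
  /ℕ-+-sameDenominator a c b = ≡.trans (/ℕ-+ a b c b)
    (/ℕ-≡ (a ℕ.* b ℕ.+ c ℕ.* b) (b ℕ.* b) (a ℕ.+ c) b {{ℕ.m*n≢0 b b}}
          (solve 3 (λ a c b → (a :* b :+ c :* b) :* b := (a :+ c) :* (b :* b)) ≡.refl a c b))

  0≤/ℕ : ∀ a b .{{_ : NonZero b}} → 0ℚ ℚ.≤ a /ℕ b
  0≤/ℕ a b = /ℕ-mono-≤ 0 1 a b ℕ.z≤n

  powℚ-/ℕ : ∀ a b .{{_ : NonZero b}} n → powℚ (a /ℕ b) n ≡ _/ℕ_ (a ℕ.^ n) (b ℕ.^ n) {{ℕ.m^n≢0 b n}}
  powℚ-/ℕ a b zero    = ≡.refl
  powℚ-/ℕ a b {{b≢0}} (suc n) =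
    ≡.trans (≡.cong (a /ℕ b *_) (powℚ-/ℕ a b n)) (/ℕ-* a b (a ℕ.^ n) (b ℕ.^ n) {{b≢0}} {{ℕ.m^n≢0 b n}})

  powℚ-/ℕ-*-≤ : ∀ a b c x n .{{_ : NonZero b}} → a ℕ.^ n ℕ.* x ℕ.≤ c ℕ.^ n ℕ.* b ℕ.^ n →
                powℚ (a /ℕ b) n * x /ℕ 1 ℚ.≤ powℚ (c /ℕ 1) n
  powℚ-/ℕ-*-≤ a b c x n aⁿx≤cⁿbⁿ = begin
    powℚ (a /ℕ b) n * x /ℕ 1           ≡⟨ ≡.cong (_* x /ℕ 1) (powℚ-/ℕ a b n) ⟩
    (a ℕ.^ n) /ℕ (b ℕ.^ n) * x /ℕ 1    ≡⟨ /ℕ-* (a ℕ.^ n) (b ℕ.^ n) x 1 ⟩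
    (a ℕ.^ n ℕ.* x) /ℕ (b ℕ.^ n ℕ.* 1) ≤⟨ /ℕ-mono-≤ (a ℕ.^ n ℕ.* x) (b ℕ.^ n ℕ.* 1) (c ℕ.^ n) (1 ℕ.^ n) cross ⟩
    (c ℕ.^ n) /ℕ (1 ℕ.^ n)             ≡⟨ powℚ-/ℕ c 1 n ⟨
    powℚ (c /ℕ 1) n                    ∎
    where
    open ℚ.≤-Reasoning
    instance
      bⁿ≢0 : NonZero (b ℕ.^ n)
      bⁿ≢0 = ℕ.m^n≢0 b n
      bⁿ*1≢0 : NonZero (b ℕ.^ n ℕ.* 1)
      bⁿ*1≢0 = ℕ.m*n≢0 (b ℕ.^ n) 1
      1ⁿ≢0 : NonZero (1 ℕ.^ n)
      1ⁿ≢0 = ℕ.m^n≢0 1 n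
    cross : a ℕ.^ n ℕ.* x ℕ.* 1 ℕ.^ n ℕ.≤ c ℕ.^ n ℕ.* (b ℕ.^ n ℕ.* 1)
    cross = ℕ.≤-trans (ℕ.≤-reflexive (≡.trans (≡.cong (a ℕ.^ n ℕ.* x ℕ.*_) (ℕ.^-zeroˡ n)) (ℕ.*-identityʳ _)))
              (ℕ.≤-trans aⁿx≤cⁿbⁿ (ℕ.≤-reflexive (≡.cong (c ℕ.^ n ℕ.*_) (≡.sym (ℕ.*-identityʳ _)))))

  powℚ-nonNeg : ∀ {x} → 0ℚ ℚ.≤ x → ∀ n → 0ℚ ℚ.≤ powℚ x n
  powℚ-nonNeg 0≤x zero    = 0≤/ℕ 1 1
  powℚ-nonNeg {x} 0≤x (suc n) =
    ℚ.≤-trans (ℚ.≤-reflexive (≡.sym (ℚ.*-zeroˡ (powℚ x n))))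
              (ℚ.*-monoʳ-≤-nonNeg (powℚ x n) {{ℚ.nonNegative (powℚ-nonNeg 0≤x n)}} 0≤x)

  powℚ-mono-≤ : ∀ {x y} → 0ℚ ℚ.≤ x → x ℚ.≤ y → ∀ n → powℚ x n ℚ.≤ powℚ y n
  powℚ-mono-≤ 0≤x x≤y zero    = ℚ.≤-refl
  powℚ-mono-≤ {x} {y} 0≤x x≤y (suc n) = ℚ.≤-trans
    (ℚ.*-monoˡ-≤-nonNeg x {{ℚ.nonNegative 0≤x}} (powℚ-mono-≤ 0≤x x≤y n))
    (ℚ.*-monoʳ-≤-nonNeg (powℚ y n) {{ℚ.nonNegative (powℚ-nonNeg (ℚ.≤-trans 0≤x x≤y) n)}} x≤y)

  module _ {A : Set} (f : A → ℚ) where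

    sumℚ-nonNeg : (∀ x → 0ℚ ℚ.≤ f x) → ∀ xs → 0ℚ ℚ.≤ sumℚ (map f xs)
    sumℚ-nonNeg 0≤f []       = ℚ.≤-refl
    sumℚ-nonNeg 0≤f (x ∷ xs) = ℚ.+-mono-≤ (0≤f x) (sumℚ-nonNeg 0≤f xs)

    sumℚ-≤ : ∀ a b .{{_ : NonZero b}} → (∀ x → f x ℚ.≤ a /ℕ b) → ∀ xs → sumℚ (map f xs) ℚ.≤ (length xs ℕ.* a) /ℕ b
    sumℚ-≤ a b f≤ []       = 0≤/ℕ 0 b
    sumℚ-≤ a b f≤ (x ∷ xs) = ℚ.≤-trans (ℚ.+-mono-≤ (f≤ x) (sumℚ-≤ a b f≤ xs))
                                       (ℚ.≤-reflexive (/ℕ-+-sameDenominator a (length xs ℕ.* a) b))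

  sumℚ-upTo-suc : ∀ (g : ℕ → ℚ) m → sumℚ (map g (upTo (suc m))) ≡ g 0 + sumℚ (map (g ∘ suc) (upTo m))
  sumℚ-upTo-suc g m = ≡.cong (λ xs → g 0 + sumℚ xs) (≡.trans (List.map-applyUpTo suc g m) (≡.sym (List.map-upTo (g ∘ suc) m)))

  telescope : ∀ (g τ : ℕ → ℚ) → (∀ j → 0ℚ ℚ.≤ τ j) → (∀ j → g j + τ (suc (suc j)) ℚ.≤ τ j) →
              ∀ m → sumℚ (map g (upTo m)) ℚ.≤ τ 0 + τ 1
  telescope g τ 0≤τ step m = begin
    S                       ≡⟨ ℚ.+-identityʳ S ⟨
    S + 0ℚ                  ≤⟨ ℚ.+-monoʳ-≤ S (ℚ.+-mono-≤ (0≤τ m) (0≤τ (suc m))) ⟩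
    S + (τ m + τ (suc m))   ≤⟨ withTail g τ step m ⟩
    τ 0 + τ 1               ∎
    where
    open ℚ.≤-Reasoning
    S = sumℚ (map g (upTo m))
    withTail : ∀ (g τ : ℕ → ℚ) → (∀ j → g j + τ (suc (suc j)) ℚ.≤ τ j) →
               ∀ m → sumℚ (map g (upTo m)) + (τ m + τ (suc m)) ℚ.≤ τ 0 + τ 1
    withTail g τ step zero    = ℚ.≤-reflexive (ℚ.+-identityˡ _)
    withTail g τ step (suc m) = begin
      sumℚ (map g (upTo (suc m))) + (τ (suc m) + τ (suc (suc m)))  ≡⟨ ≡.cong (_+ (τ (suc m) + τ (suc (suc m)))) (sumℚ-upTo-suc g m) ⟩
      g 0 + S′ + (τ (suc m) + τ (suc (suc m)))                      ≡⟨ ℚ.+-assoc (g 0) S′ _ ⟩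
      g 0 + (S′ + (τ (suc m) + τ (suc (suc m))))                    ≤⟨ ℚ.+-monoʳ-≤ (g 0) (withTail (g ∘ suc) (τ ∘ suc) (step ∘ suc) m) ⟩
      g 0 + (τ 1 + τ 2)                                             ≡⟨ ≡.cong (_+_ (g 0)) (ℚ.+-comm (τ 1) (τ 2)) ⟩
      g 0 + (τ 2 + τ 1)                                             ≡⟨ ℚ.+-assoc (g 0) (τ 2) (τ 1) ⟨
      g 0 + τ 2 + τ 1                                               ≤⟨ ℚ.+-monoˡ-≤ (τ 1) (step 0) ⟩
      τ 0 + τ 1                                                     ∎
      where S′ = sumℚ (map (g ∘ suc) (upTo m))

-- The tail bound
2≤q : (F : FiniteField) → 2 ≤ FF.q F
2≤q F = 2≤length elements (complete 0#) (complete 1#)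
  where
  open FiniteField F
  2≤length : ∀ xs → Any (0# ≈_) xs → Any (1# ≈_) xs → 2 ≤ length xs
  2≤length (x ∷ y ∷ xs) _          _           = s≤s (s≤s z≤n)
  2≤length (x ∷ [])     (here 0≈x) (here 1≈x) = ⊥-elim (0≉1 (trans 0≈x (sym 1≈x)))

∣signPow∣≡1 : ∀ k → ∣ signPow k ∣ ≡ 1
∣signPow∣≡1 zero    = ≡.refl
∣signPow∣≡1 (suc k) = ≡.trans (ℤ.∣-i∣≡∣i∣ (signPow k)) (∣signPow∣≡1 k)

module TailBound (F : FiniteField) (a D : ℕ) .{{_ : NonZero D}} where
  open import Data.Nat using (_+_; _*_)
  open import Data.Nat.DivMod using (_/_; m/n≤m)
  open FiniteField F using (Carrier)
  open FF F
  open Polynomials F using (length-vecs; irreducibleDivisorCount; irreducibleDivisorCount≤q^d; weighted-irreducibleDivisorCount≤degree)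
  open ExponentBound a D

  infix 7.5 _/q^_
  _/q^_ : ℕ → ℕ → ℚ
  a /q^ x = _/ℕ_ a (q ^ x) {{ℕ.m^n≢0 q x}}

  /q^-mono-≤ : ∀ a x b y → a * q ^ y ≤ b * q ^ x → a /q^ x ℚ.≤ b /q^ y
  /q^-mono-≤ a x b y = /ℕ-mono-≤ a (q ^ x) b (q ^ y) {{ℕ.m^n≢0 q x}} {{ℕ.m^n≢0 q y}}

  /q^-+ : ∀ a b x → a /q^ x ℚ.+ b /q^ x ≡ (a + b) /q^ x
  /q^-+ a b x = /ℕ-+-sameDenominator a b (q ^ x) {{ℕ.m^n≢0 q x}}

  0≤/q^ : ∀ a x → 0ℚ ℚ.≤ a /q^ x
  0≤/q^ a x = 0≤/ℕ a (q ^ x) {{ℕ.m^n≢0 q x}}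

  ∣μ∣≤1 : ∀ e (y : Vec Carrier e) → ∣ μ e y ∣ ≤ 1
  ∣μ∣≤1 e y with squarefree? e y
  ... | true  = ℕ.≤-reflexive (∣signPow∣≡1 (ω e y))
  ... | false = z≤n

  ω-bound : ∀ t e (y : Vec Carrier e) → suc t * ω e y ≤ suc t * suc t * q ^ t + e
  ω-bound t e y = count-bound (irreducibleDivisorCount y) q t e
    (irreducibleDivisorCount≤q^d y) (weighted-irreducibleDivisorCount≤degree y)

  ω≤suc-degree : ∀ e (y : Vec Carrier e) → ω e y ≤ suc e
  ω≤suc-degree e y = ≡.subst (_≤ suc e) (ℕ.*-identityˡ (ω e y)) (ω-bound 0 e y)

  module _ {n} (n₀≤n : n₀ ≤ n) where

    n∸n/D : ℕ
    n∸n/D = n ∸ n / D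

    2^aω≤ : ∀ j (y : Vec Carrier (suc (n + j))) → 2 ^ (a * ω _ y) ≤ q ^ (n / D + ⌈ j /2⌉)
    2^aω≤ j y = 2^aw≤q^[n/D+⌈j/2⌉] q (2≤q F) j (ω _ y) n₀≤n (ω≤suc-degree _ y) (ω-bound t _ y)

    term≤ : ∀ j (y : Vec Carrier (suc (n + j))) → term a _ y ℚ.≤ q ^ (n / D + ⌈ j /2⌉) /q^ (2 * suc (n + j))
    term≤ j y = /q^-mono-≤ (∣ μ e y ∣ * 2 ^ (a * ω e y)) (2 * e) (q ^ (n / D + ⌈ j /2⌉)) (2 * e)
      (ℕ.*-monoˡ-≤ (q ^ (2 * e)) (ℕ.≤-trans (ℕ.*-monoˡ-≤ (2 ^ (a * ω e y)) (∣μ∣≤1 e y))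
                                               (ℕ.≤-trans (ℕ.≤-reflexive (ℕ.*-identityˡ _)) (2^aω≤ j y))))
      where e = suc (n + j)

    degSum≤ : ∀ j → degSum a (suc (n + j)) ℚ.≤ 1 /q^ suc (⌊ j /2⌋ + n∸n/D)
    degSum≤ j = ℚ.≤-trans (sumℚ-≤ (term a e) (q ^ (s + u)) (q ^ (2 * e)) {{ℕ.m^n≢0 q (2 * e)}} (term≤ j) (vecs e))
      (/q^-mono-≤ (length (vecs e) * q ^ (s + u)) (2 * e) 1 (suc (h + n∸n/D)) (ℕ.≤-reflexive (begin
      length (vecs e) * q ^ (s + u) * q ^ suc (h + n∸n/D)   ≡⟨ ≡.cong (λ l → l * q ^ (s + u) * q ^ suc (h + n∸n/D)) (length-vecs e) ⟩
      q ^ e * q ^ (s + u) * q ^ suc (h + n∸n/D)             ≡⟨ ≡.cong (_* q ^ suc (h + n∸n/D)) (ℕ.^-distribˡ-+-* q e (s + u)) ⟨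
      q ^ (e + (s + u)) * q ^ suc (h + n∸n/D)               ≡⟨ ℕ.^-distribˡ-+-* q (e + (s + u)) (suc (h + n∸n/D)) ⟨
      q ^ (e + (s + u) + suc (h + n∸n/D))                   ≡⟨ ≡.cong (q ^_) exponent ⟩
      q ^ (2 * e)                                       ≡⟨ ℕ.*-identityˡ _ ⟨
      1 * q ^ (2 * e)                                   ∎)))
      where
      open ≡.≡-Reasoning
      e = suc (n + j)
      s = n / D
      u = ⌈ j /2⌉
      h = ⌊ j /2⌋
      exponent : e + (s + u) + suc (h + n∸n/D) ≡ 2 * e
      exponent = begin
        e + (s + u) + suc (h + n∸n/D)
          ≡⟨ solve 5 (λ e s u h r → e :+ (s :+ u) :+ (con 1 :+ (h :+ r)) := e :+ (con 1 :+ ((s :+ r) :+ (h :+ u))))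
                     ≡.refl e s u h n∸n/D ⟩
        e + suc (s + n∸n/D + (h + u))   ≡⟨ ≡.cong₂ (λ x y → e + suc (x + y)) (ℕ.m+[n∸m]≡n (m/n≤m n D)) (ℕ.⌊n/2⌋+⌈n/2⌉≡n j) ⟩
        e + e                       ≡⟨ ≡.cong (e +_) (ℕ.+-identityʳ e) ⟨
        2 * e                       ∎

    halves : ∀ x → 1 /q^ suc x ℚ.+ 1 /q^ suc x ℚ.≤ 1 /q^ x
    halves x = ℚ.≤-trans (ℚ.≤-reflexive (/q^-+ 1 1 (suc x)))
      (/q^-mono-≤ 2 (suc x) 1 x (ℕ.≤-trans (ℕ.*-monoˡ-≤ (q ^ x) (2≤q F)) (ℕ.≤-reflexive (≡.sym (ℕ.*-identityˡ _)))))

    partialSum≤ : ∀ m → partialSum a n m ℚ.≤ 2 /q^ n∸n/D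
    partialSum≤ m = ℚ.≤-trans (telescope g τ (λ j → 0≤/q^ 1 (⌊ j /2⌋ + n∸n/D)) step m) (ℚ.≤-reflexive (/q^-+ 1 1 n∸n/D))
      where
      g : ℕ → ℚ
      g j = degSum a (suc (n + j))
      τ : ℕ → ℚ
      τ j = 1 /q^ (⌊ j /2⌋ + n∸n/D)
      step : ∀ j → g j ℚ.+ τ (suc (suc j)) ℚ.≤ τ j
      step j = ℚ.≤-trans (ℚ.+-monoˡ-≤ (τ (suc (suc j))) (degSum≤ j)) (halves (⌊ j /2⌋ + n∸n/D))

    partialSum-nonNeg : ∀ m → 0ℚ ℚ.≤ partialSum a n m
    partialSum-nonNeg m = sumℚ-nonNeg (λ j → degSum a (suc (n + j))) (λ j → degSum-nonNeg (suc (n + j))) (upTo m)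
      where
      degSum-nonNeg : ∀ e → 0ℚ ℚ.≤ degSum a e
      degSum-nonNeg e = sumℚ-nonNeg (term a e) (λ y → 0≤/q^ (∣ μ e y ∣ * 2 ^ (a * ω e y)) (2 * e)) (vecs e)

    tailBound : ∀ {k} → 0 < k → ∀ m →
      powℚ (partialSum a n m) D ℚ.* (q ^ ((D ∸ k) * n)) /ℕ 1 ℚ.≤ powℚ (3 /ℕ 1) D
    tailBound {k} 0<k m = ℚ.≤-trans
      (ℚ.*-monoʳ-≤-nonNeg (X /ℕ 1) {{ℚ.nonNegative (0≤/ℕ X 1)}} (powℚ-mono-≤ (partialSum-nonNeg m) (partialSum≤ m) D))
      (powℚ-/ℕ-*-≤ 2 (q ^ n∸n/D) 3 X D {{ℕ.m^n≢0 q n∸n/D}}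
        (ℕ.*-mono-≤ (ℕ.^-monoˡ-≤ D (s≤s (s≤s z≤n))) X≤[q^[n∸n/D]]^D))
      where
      X = q ^ ((D ∸ k) * n)
      X≤[q^[n∸n/D]]^D : X ≤ (q ^ n∸n/D) ^ D
      X≤[q^[n∸n/D]]^D =
        ℕ.≤-trans (ℕ.^-monoʳ-≤ q ([D∸k]*n≤[n∸n/D]*D n 0<k)) (ℕ.≤-reflexive (≡.sym (ℕ.^-*-assoc q n∸n/D D)))

open import Data.Nat using (_*_)
open import Data.Integer using (+_)
open import Data.Rational using (_/_)

mainTheorem11 : (a k D : ℕ) → 0 < k → 2 * k < D →
    ∃[ n₀ ] ((F : FiniteField) → (n : ℕ) → n₀ ≤ n → (m : ℕ) →
      Data.Rational._≤_
        (Data.Rational._*_ (powℚ (FF.partialSum F a n m) D) ((+ (FF.q F ^ ((D ∸ k) * n))) / 1))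
        (powℚ ((+ 3) / 1) D))
mainTheorem11 a k D@(suc _) 0<k _ =
  ExponentBound.n₀ a D , λ F n n₀≤n m → TailBound.tailBound F a D n₀≤n 0<k m
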